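{- Let $r,t,s$ be non-negative integers with $r+t>0$ and let $\varepsilon\in\{1,-1\}$. Then, as formal power series in $q$, \[\sum_{\pi\in\mathcal{D}} (-1)^{\lceil\mathcal{E}\rceil(\pi)}\varepsilon^{\lfloor\mathcal{E}\rfloor(\pi)} q^{r\lceil\mathcal{O}\rceil(\pi)+t\lfloor\mathcal{O}\rfloor(\pi)+s\lfloor\mathcal{E}\rfloor(\pi)} = (-q^r;-\varepsilon q^{r+t+s})_\infty,\] \[\sum_{\pi\in\mathcal{P}} (-1)^{\lceil\mathcal{E}\rceil(\pi)}\varepsilon^{\lfloor\mathcal{E}\rfloor(\pi)} q^{r\lceil\mathcal{O}\rceil(\pi)+t\lfloor\mathcal{O}\rfloor(\pi)+s\lfloor\mathcal{E}\rfloor(\pi)} = \frac{1}{(-\varepsilon q^{r+t+s};-\varepsilon q^{r+t+s})_\infty}.\]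
   Context: A partition $\pi=(\lambda_1,\lambda_2,\dots)$ is a finite non-increasing sequence of positive integers; the empty sequence is the unique partition of $0$. $\mathcal{P}$ is the set of all partitions, $\mathcal{D}$ the set of partitions into distinct parts. $\lceil\mathcal{O}\rceil(\pi)=\sum_{i\ge1}\lceil\lambda_{2i-1}/2\rceil$, $\lfloor\mathcal{O}\rfloor(\pi)=\sum_{i\ge1}\lfloor\lambda_{2i-1}/2\rfloor$, $\lceil\mathcal{E}\rceil(\pi)=\sum_{i\ge1}\lceil\lambda_{2i}/2\rceil$, $\lfloor\mathcal{E}\rfloor(\pi)=\sum_{i\ge1}\lfloor\lambda_{2i}/2\rfloor$. $(a;q)_\infty=\prod_{i\ge0}(1-aq^i)$. -}

module Defs where

open import Data.Nat as ℕ using (ℕ; zero; suc; _<_; _>_; _≥_; ⌊_/2⌋; ⌈_/2⌉; _≡ᵇ_; _∸_)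
open import Data.Integer as ℤ using (ℤ; 0ℤ; 1ℤ; -1ℤ)
open import Data.List using (List; []; _∷_; map; foldr; upTo; zipWith)
open import Data.List.Relation.Unary.All using (All)
open import Data.List.Relation.Unary.Linked using (Linked)
open import Data.Product using (_×_)
open import Data.Bool using (if_then_else_)

IsPartition : List ℕ → Set
IsPartition π = All (0 <_) π × Linked _≥_ π

IsDistinctPartition : List ℕ → Set
IsDistinctPartition π = All (0 <_) π × Linked _>_ π

-- odd-indexed parts λ₁, λ₃, … and even-indexed parts λ₂, λ₄, …
oddParts evenParts : List ℕ → List ℕ
oddParts [] = []
oddParts (x ∷ xs) = x ∷ evenParts xs
evenParts [] = []
evenParts (x ∷ xs) = oddParts xs

sumℕ : List ℕ → ℕ
sumℕ = foldr ℕ._+_ 0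

⌈O⌉ ⌊O⌋ ⌈E⌉ ⌊E⌋ : List ℕ → ℕ
⌈O⌉ π = sumℕ (map ⌈_/2⌉ (oddParts π))
⌊O⌋ π = sumℕ (map ⌊_/2⌋ (oddParts π))
⌈E⌉ π = sumℕ (map ⌈_/2⌉ (evenParts π))
⌊E⌋ π = sumℕ (map ⌊_/2⌋ (evenParts π))

expo : ℕ → ℕ → ℕ → List ℕ → ℕ
expo r t s π = r ℕ.* ⌈O⌉ π ℕ.+ t ℕ.* ⌊O⌋ π ℕ.+ s ℕ.* ⌊E⌋ π

weight : ℤ → List ℕ → ℤ
weight ε π = (-1ℤ ℤ.^ ⌈E⌉ π) ℤ.* (ε ℤ.^ ⌊E⌋ π)

sumℤ : List ℤ → ℤ
sumℤ = foldr ℤ._+_ 0ℤ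

Series : Set
Series = ℕ → ℤ

one : Series
one zero = 1ℤ
one (suc _) = 0ℤ

mono : ℤ → ℕ → Series
mono c d n = if n ≡ᵇ d then c else 0ℤ

_⊕_ _⊖_ : Series → Series → Series
(f ⊕ g) n = f n ℤ.+ g n
(f ⊖ g) n = f n ℤ.- g n

_⊛_ : Series → Series → Series
(f ⊛ g) n = sumℤ (map (λ k → f k ℤ.* g (n ∸ k)) (upTo (suc n)))

prodUpTo : ℕ → (ℕ → Series) → Series
prodUpTo n F = foldr (λ i acc → F i ⊛ acc) one (upTo n)

-- The q-Pochhammer symbol (a;x)_∞ = ∏_{i≥0} (1 - a x^i) for monomials
-- a = c q^d and x = c' q^e with e ≥ 1.  Since the i-th factor is
-- 1 + O(q^{i}) (indeed 1 + O(q^{d+e i})), the coefficient of q^N of the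
-- infinite product equals that of the finite product over i = 0..N.
pochFactor : ℤ → ℕ → ℤ → ℕ → ℕ → Series
pochFactor c d c' e i = one ⊖ mono (c ℤ.* (c' ℤ.^ i)) (d ℕ.+ e ℕ.* i)

poch∞ : ℤ → ℕ → ℤ → ℕ → Series
poch∞ c d c' e N = prodUpTo (suc N) (pochFactor c d c' e) N

-- Multiplicative inverse of a series a with a 0 = 1:
-- b 0 = 1, b (n+1) = - Σ_{k=1}^{n+1} a k * b (n+1-k).
-- invRev a n = b n ∷ b (n-1) ∷ … ∷ b 0
invRev : Series → ℕ → List ℤ
invRev a zero = 1ℤ ∷ []
invRev a (suc n) =
  let bs = invRev a n in
  ℤ.- sumℤ (zipWith ℤ._*_ (map (λ k → a (suc k)) (upTo (suc n))) bs) ∷ bs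

recip : Series → Series
recip a n with invRev a n
... | b ∷ _ = b
... | [] = 0ℤ

{-# OPTIONS --safe #-}
-- Let Fᵒ m and Fᵉ m be the generating functions of the (distinct) partitions with parts at most m,
-- weighted as if the first part had an odd, resp. even, index.  Removing the largest part m,
-- of weight a m resp. b m, gives for distinct parts the coupled recurrences
--   Fᵒ m = Fᵒ (m - 1) + a m Fᵉ (m - 1),   Fᵉ m = Fᵉ (m - 1) + b m Fᵒ (m - 1),
-- and for all partitions the same with Fᵉ m and Fᵒ m on the right.  Passing from 2j to 2j + 1
-- increases ⌈x/2⌉ but not ⌊x/2⌋, so b (2j + 1) = - b (2j).  Hence Fᵉ vanishes at every odd m,
-- and Fᵒ (2k + 1) is the product of the 1 + a (2j + 1) b (2j), j ≤ k, for distinct parts, and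
-- the inverse of the product of the 1 - a (2j) b (2j), 1 ≤ j ≤ k, for all partitions.  These
-- are the factors of the two q-Pochhammer symbols.  All identities are proved coefficientwise
-- modulo q^(N+1), where only finitely many partitions contribute.
module Submission where

open import Defs
open import Data.Bool using (Bool; true; false; if_then_else_; T)
open import Data.Empty using (⊥-elim)
open import Data.Integer using (ℤ; 0ℤ; 1ℤ; -1ℤ; -_) renaming (_+_ to _+ᶻ_; _*_ to _*ᶻ_; _^_ to _^ᶻ_)
import Data.Integer.Properties as ℤP
import Data.Integer.Tactic.RingSolver as ℤ-Solver
open import Data.List using (List; []; _∷_; _++_; map; foldr; upTo; applyUpTo; concatMap; zipWith; length; filter)
import Data.List.Extrema as Extrema
open import Data.List.Membership.Propositional using (_∈_)
open import Data.List.Membership.Propositional.Properties using (∈-map⁺; ∈-map⁻; ∈-++⁺ˡ; ∈-++⁺ʳ; ∈-++⁻; ∈-filter⁺; ∈-filter⁻)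
open import Data.List.Membership.Propositional.Properties.WithK using (unique∧set⇒bag)
import Data.List.Properties as LP
open import Data.List.Relation.Binary.BagAndSetEquality using (∼bag⇒↭)
open import Data.List.Relation.Binary.Disjoint.Propositional using (Disjoint)
open import Data.List.Relation.Binary.Permutation.Propositional using (↭⇒↭ₛ)
import Data.List.Relation.Binary.Permutation.Propositional.Properties as ↭P
open import Data.List.Relation.Unary.All as All using (All; []; _∷_)
import Data.List.Relation.Unary.All.Properties as AllP
import Data.List.Relation.Unary.AllPairs as AllPairs
open import Data.List.Relation.Unary.Any using (here; there)
open import Data.List.Relation.Unary.Linked as Linked using (Linked; []; [-]; _∷_)
open import Data.List.Relation.Unary.Linked.Properties using (Linked⇒AllPairs)
open import Data.List.Relation.Unary.Unique.Propositional using (Unique)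
import Data.List.Relation.Unary.Unique.Propositional.Properties as Unique
import Data.Nat as ℕ
open import Data.Nat using (ℕ; zero; suc; _+_; _*_; _∸_; _≤_; _<_; _>_; _≥_; z≤n; s≤s; _≡ᵇ_; _≤ᵇ_; _<ᵇ_; ⌊_/2⌋; ⌈_/2⌉)
open import Data.Nat.Divisibility using (_∣_; _∣?_; divides; ∣m+n∣m⇒∣n; ∣m∣n⇒∣m+n; m∣m*n; ∣-refl)
open import Data.Nat.Induction using (<-rec)
import Data.Nat.Properties as ℕP
import Data.Nat.Tactic.RingSolver as ℕ-Solver
open import Data.Product using (Σ; _×_; _,_; proj₁; proj₂)
open import Data.Sum using (_⊎_; inj₁; inj₂)
open import Function using (_∘_)
open import Function.Bundles using (_⇔_; mk⇔; Equivalence)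
open import Relation.Binary.Bundles using (Setoid)
open import Relation.Binary.Definitions using (Tri; tri<; tri≈; tri>)
open import Relation.Binary.PropositionalEquality
import Relation.Binary.Reasoning.Setoid
open import Relation.Nullary using (¬_; Dec; yes; no; does)

open import Algebra.Properties.AbelianGroup ℤP.+-0-abelianGroup using (∙-cancelʳ)
open import Algebra.Properties.CommutativeSemigroup ℤP.+-commutativeSemigroup using () renaming (interchange to +-interchange)
open import Algebra.Properties.CommutativeSemigroup ℤP.*-commutativeSemigroup using () renaming (interchange to *-interchange)
import Data.List.Relation.Binary.Permutation.Setoid.Properties (setoid ℤ) as ↭ₛ

private
  variable
    X Y : Set

-- Finite sums

∑ : (X → ℤ) → List X → ℤ
∑ f xs = sumℤ (map f xs)

∑-++ : (f : X → ℤ) (xs ys : List X) → ∑ f (xs ++ ys) ≡ ∑ f xs +ᶻ ∑ f ys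
∑-++ f [] ys = sym (ℤP.+-identityˡ _)
∑-++ f (x ∷ xs) ys = trans (cong (f x +ᶻ_) (∑-++ f xs ys)) (sym (ℤP.+-assoc (f x) _ _))

∑-cong : {f g : X → ℤ} → (∀ x → f x ≡ g x) → (xs : List X) → ∑ f xs ≡ ∑ g xs
∑-cong f≗g [] = refl
∑-cong f≗g (x ∷ xs) = cong₂ _+ᶻ_ (f≗g x) (∑-cong f≗g xs)

∑-map : (f : Y → ℤ) (g : X → Y) (xs : List X) → ∑ f (map g xs) ≡ ∑ (f ∘ g) xs
∑-map f g [] = refl
∑-map f g (x ∷ xs) = cong (f (g x) +ᶻ_) (∑-map f g xs)

∑-concatMap : (f : Y → ℤ) (g : X → List Y) (xs : List X) →
  ∑ f (concatMap g xs) ≡ ∑ (λ x → ∑ f (g x)) xs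
∑-concatMap f g [] = refl
∑-concatMap f g (x ∷ xs) =
  trans (∑-++ f (g x) (concatMap g xs)) (cong (∑ f (g x) +ᶻ_) (∑-concatMap f g xs))

∑-zero : (xs : List X) → ∑ (λ _ → 0ℤ) xs ≡ 0ℤ
∑-zero [] = refl
∑-zero (x ∷ xs) = trans (ℤP.+-identityˡ _) (∑-zero xs)

∑-+ : (f g : X → ℤ) (xs : List X) → ∑ (λ x → f x +ᶻ g x) xs ≡ ∑ f xs +ᶻ ∑ g xs
∑-+ f g [] = refl
∑-+ f g (x ∷ xs) =
  trans (cong (f x +ᶻ g x +ᶻ_) (∑-+ f g xs)) (+-interchange (f x) (g x) (∑ f xs) (∑ g xs))

∑-*ˡ : (c : ℤ) (f : X → ℤ) (xs : List X) → ∑ (λ x → c *ᶻ f x) xs ≡ c *ᶻ ∑ f xs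
∑-*ˡ c f [] = sym (ℤP.*-zeroʳ c)
∑-*ˡ c f (x ∷ xs) = trans (cong (c *ᶻ f x +ᶻ_) (∑-*ˡ c f xs)) (sym (ℤP.*-distribˡ-+ c (f x) _))

∑-*ʳ : (c : ℤ) (f : X → ℤ) (xs : List X) → ∑ (λ x → f x *ᶻ c) xs ≡ ∑ f xs *ᶻ c
∑-*ʳ c f xs = trans (∑-cong (λ x → ℤP.*-comm (f x) c) xs) (trans (∑-*ˡ c f xs) (ℤP.*-comm c _))

∑-swap : (h : X → Y → ℤ) (xs : List X) (ys : List Y) →
  ∑ (λ x → ∑ (h x) ys) xs ≡ ∑ (λ y → ∑ (λ x → h x y) xs) ys
∑-swap h [] ys = sym (∑-zero ys)
∑-swap h (x ∷ xs) ys = trans (cong (∑ (h x) ys +ᶻ_) (∑-swap h xs ys))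
  (sym (∑-+ (h x) (λ y → ∑ (λ x → h x y) xs) ys))

∑-upTo-cong : {f g : ℕ → ℤ} (M : ℕ) → (∀ k → k < M → f k ≡ g k) → ∑ f (upTo M) ≡ ∑ g (upTo M)
∑-upTo-cong zero f≗g = refl
∑-upTo-cong {f} {g} (suc M) f≗g = begin
  ∑ f (upTo (suc M))            ≡⟨ cong (∑ f) (sym (LP.upTo-∷ʳ M)) ⟩
  ∑ f (upTo M ++ M ∷ [])        ≡⟨ ∑-++ f (upTo M) (M ∷ []) ⟩
  ∑ f (upTo M) +ᶻ (f M +ᶻ 0ℤ)   ≡⟨ cong₂ _+ᶻ_ (∑-upTo-cong M (λ k k<M → f≗g k (ℕP.m<n⇒m<1+n k<M)))
                                              (cong (_+ᶻ 0ℤ) (f≗g M ℕP.≤-refl)) ⟩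
  ∑ g (upTo M) +ᶻ (g M +ᶻ 0ℤ)   ≡⟨ sym (∑-++ g (upTo M) (M ∷ [])) ⟩
  ∑ g (upTo M ++ M ∷ [])        ≡⟨ cong (∑ g) (LP.upTo-∷ʳ M) ⟩
  ∑ g (upTo (suc M))            ∎
  where open ≡-Reasoning

<ᵇ-true : ∀ {m n} → m < n → (m <ᵇ n) ≡ true
<ᵇ-true {zero} {suc n} _ = refl
<ᵇ-true {suc m} {suc n} (s≤s m<n) = <ᵇ-true {m} {n} m<n

<ᵇ-false : ∀ {m n} → n ≤ m → (m <ᵇ n) ≡ false
<ᵇ-false {m} {zero} _ = refl
<ᵇ-false {suc m} {suc n} (s≤s n≤m) = <ᵇ-false {m} {n} n≤m

≤ᵇ-true : ∀ {m n} → m ≤ n → (m ≤ᵇ n) ≡ true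
≤ᵇ-true {zero} _ = refl
≤ᵇ-true {suc m} m<n = <ᵇ-true m<n

≤ᵇ-false : ∀ {m n} → n < m → (m ≤ᵇ n) ≡ false
≤ᵇ-false {suc m} (s≤s n≤m) = <ᵇ-false n≤m

≡ᵇ-refl : ∀ n → (n ≡ᵇ n) ≡ true
≡ᵇ-refl zero = refl
≡ᵇ-refl (suc n) = ≡ᵇ-refl n

≡ᵇ-false : ∀ {m n} → m ≢ n → (m ≡ᵇ n) ≡ false
≡ᵇ-false {zero} {zero} m≢n = ⊥-elim (m≢n refl)
≡ᵇ-false {zero} {suc n} _ = refl
≡ᵇ-false {suc m} {zero} _ = refl
≡ᵇ-false {suc m} {suc n} m≢n = ≡ᵇ-false {m} {n} (m≢n ∘ cong suc)

+-≡ᵇ-cancelˡ : ∀ d m e → (d + m ≡ᵇ d + e) ≡ (m ≡ᵇ e)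
+-≡ᵇ-cancelˡ zero m e = refl
+-≡ᵇ-cancelˡ (suc d) m e = +-≡ᵇ-cancelˡ d m e

when : Bool → ℤ → ℤ
when b c = if b then c else 0ℤ

*-when : ∀ b c x → c *ᶻ when b x ≡ when b (c *ᶻ x)
*-when true c x = refl
*-when false c x = ℤP.*-zeroʳ c

∑-when : (b : Bool) (c : ℤ) (f : X → ℤ) (xs : List X) →
  ∑ (λ x → when b (c *ᶻ f x)) xs ≡ when b (c *ᶻ ∑ f xs)
∑-when true c f xs = ∑-*ˡ c f xs
∑-when false c f xs = ∑-zero xs

∑-upTo-indicator : (d : ℕ) (h : ℕ → ℤ) (M : ℕ) →
  ∑ (λ k → when (k ≡ᵇ d) (h k)) (upTo M) ≡ when (d <ᵇ M) (h d)
∑-upTo-indicator d h zero = refl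
∑-upTo-indicator d h (suc M) = begin
  ∑ δ (upTo (suc M))                  ≡⟨ cong (∑ δ) (sym (LP.upTo-∷ʳ M)) ⟩
  ∑ δ (upTo M ++ M ∷ [])              ≡⟨ ∑-++ δ (upTo M) (M ∷ []) ⟩
  ∑ δ (upTo M) +ᶻ (δ M +ᶻ 0ℤ)         ≡⟨ cong₂ _+ᶻ_ (∑-upTo-indicator d h M) (ℤP.+-identityʳ (δ M)) ⟩
  when (d <ᵇ M) (h d) +ᶻ δ M          ≡⟨ last-term (ℕP.<-cmp d M) ⟩
  when (d <ᵇ suc M) (h d)             ∎
  where
  open ≡-Reasoning
  δ : ℕ → ℤ
  δ k = when (k ≡ᵇ d) (h k)
  last-term : Tri (d < M) (d ≡ M) (M < d) → when (d <ᵇ M) (h d) +ᶻ δ M ≡ when (d <ᵇ suc M) (h d)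
  last-term (tri< d<M _ _) rewrite <ᵇ-true d<M | <ᵇ-true (ℕP.m<n⇒m<1+n d<M)
    | ≡ᵇ-false {M} {d} (λ M≡d → ℕP.<-irrefl (sym M≡d) d<M) = ℤP.+-identityʳ (h d)
  last-term (tri≈ _ refl _) rewrite <ᵇ-false {d} {d} ℕP.≤-refl | <ᵇ-true (ℕP.n<1+n d)
    | ≡ᵇ-refl d = ℤP.+-identityˡ (h d)
  last-term (tri> _ _ M<d) rewrite <ᵇ-false {d} {M} (ℕP.<⇒≤ M<d) | <ᵇ-false {d} {suc M} M<d
    | ≡ᵇ-false {M} {d} (λ M≡d → ℕP.<-irrefl M≡d M<d) = refl

-- Polynomials

-- A polynomial is a list of monomials c q^d, read as their formal sum; lists are not
-- normalised, so polynomials are only ever compared through their coefficients.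
Monomial : Set
Monomial = ℤ × ℕ

Poly : Set
Poly = List Monomial

1ᵐ : Monomial
1ᵐ = (1ℤ , 0)

negᵐ : Monomial → Monomial
negᵐ (c , d) = (- c , d)

_·_ : Monomial → Monomial → Monomial
(a , d) · (b , e) = (a *ᶻ b , d + e)

·-comm : ∀ u v → u · v ≡ v · u
·-comm (a , d) (b , e) = cong₂ _,_ (ℤP.*-comm a b) (ℕP.+-comm d e)

·-assoc : ∀ u v w → (u · v) · w ≡ u · (v · w)
·-assoc (a , d) (b , e) (c , f) = cong₂ _,_ (ℤP.*-assoc a b c) (ℕP.+-assoc d e f)

·-identityʳ : ∀ u → u · 1ᵐ ≡ u
·-identityʳ (c , d) = cong₂ _,_ (ℤP.*-identityʳ c) (ℕP.+-identityʳ d)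

negᵐ-·-negᵐ : ∀ u v → negᵐ (u · negᵐ v) ≡ u · v
negᵐ-·-negᵐ (c , d) (c′ , d′) = cong (_, d + d′) (lemma c c′)
  where
  lemma : ∀ c c′ → - (c *ᶻ - c′) ≡ c *ᶻ c′
  lemma = ℤ-Solver.solve-∀

coeffᵐ : ℕ → Monomial → ℤ
coeffᵐ n (c , d) = when (n ≡ᵇ d) c

coeff : Poly → Series
coeff A n = ∑ (coeffᵐ n) A

_⊙_ : Monomial → Poly → Poly
u ⊙ A = map (u ·_) A

_**_ : Poly → Poly → Poly
A ** B = concatMap (_⊙ B) A

infixr 7 _⊙_
infixl 7 _**_

⊙-distrib-++ : ∀ u A B → u ⊙ (A ++ B) ≡ u ⊙ A ++ u ⊙ B
⊙-distrib-++ u = LP.map-++ (u ·_)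

_⊙ˢ_ : Monomial → Series → Series
((c , d) ⊙ˢ g) n = when (d ≤ᵇ n) (c *ᶻ g (n ∸ d))

coeffᵐ-· : ∀ n u v → coeffᵐ n (u · v) ≡ (u ⊙ˢ (λ m → coeffᵐ m v)) n
coeffᵐ-· n (c , d) (b , e) with ℕP.≤-<-connex d n
... | inj₁ d≤n rewrite ≤ᵇ-true d≤n = begin
  when (n ≡ᵇ d + e) (c *ᶻ b)
    ≡⟨ cong (λ m → when (m ≡ᵇ d + e) (c *ᶻ b)) (sym (ℕP.m+[n∸m]≡n d≤n)) ⟩
  when (d + (n ∸ d) ≡ᵇ d + e) (c *ᶻ b)
    ≡⟨ cong (λ z → when z (c *ᶻ b)) (+-≡ᵇ-cancelˡ d (n ∸ d) e) ⟩
  when ((n ∸ d) ≡ᵇ e) (c *ᶻ b)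
    ≡⟨ sym (*-when ((n ∸ d) ≡ᵇ e) c b) ⟩
  c *ᶻ when ((n ∸ d) ≡ᵇ e) b ∎
  where open ≡-Reasoning
... | inj₂ n<d rewrite ≤ᵇ-false n<d
  | ≡ᵇ-false {n} {d + e} (λ n≡d+e → ℕP.<⇒≱ n<d (subst (d ≤_) (sym n≡d+e) (ℕP.m≤m+n d e))) = refl

coeff-++ : ∀ A B n → coeff (A ++ B) n ≡ coeff A n +ᶻ coeff B n
coeff-++ A B n = ∑-++ (coeffᵐ n) A B

coeff-⊙ : ∀ u A n → coeff (u ⊙ A) n ≡ (u ⊙ˢ coeff A) n
coeff-⊙ (c , d) A n = begin
  ∑ (coeffᵐ n) (map ((c , d) ·_) A)                ≡⟨ ∑-map (coeffᵐ n) ((c , d) ·_) A ⟩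
  ∑ (λ v → coeffᵐ n ((c , d) · v)) A               ≡⟨ ∑-cong (coeffᵐ-· n (c , d)) A ⟩
  ∑ (λ v → when (d ≤ᵇ n) (c *ᶻ coeffᵐ (n ∸ d) v)) A ≡⟨ ∑-when (d ≤ᵇ n) c (coeffᵐ (n ∸ d)) A ⟩
  ((c , d) ⊙ˢ coeff A) n                           ∎
  where open ≡-Reasoning

coeff-**-⊙ˢ : ∀ A B n → coeff (A ** B) n ≡ ∑ (λ u → (u ⊙ˢ coeff B) n) A
coeff-**-⊙ˢ A B n = trans (∑-concatMap (coeffᵐ n) (_⊙ B) A) (∑-cong (λ u → coeff-⊙ u B n) A)

∑-** : ∀ (f : Monomial → ℤ) A B → ∑ f (A ** B) ≡ ∑ (λ u → ∑ (λ v → f (u · v)) B) A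
∑-** f A B = trans (∑-concatMap f (_⊙ B) A) (∑-cong (λ u → ∑-map f (u ·_) B) A)

coeff-**-pairs : ∀ A B n → coeff (A ** B) n ≡ ∑ (λ u → ∑ (λ v → coeffᵐ n (u · v)) B) A
coeff-**-pairs A B n = ∑-** (coeffᵐ n) A B

⊙ˢ-as-⊛ : ∀ u g n → (u ⊙ˢ g) n ≡ ((λ k → coeffᵐ k u) ⊛ g) n
⊙ˢ-as-⊛ (c , d) g n = begin
  when (d ≤ᵇ n) (c *ᶻ g (n ∸ d))
    ≡⟨ cong (λ z → when z (c *ᶻ g (n ∸ d))) (≤ᵇ≡<ᵇ-suc d) ⟩
  when (d <ᵇ suc n) (c *ᶻ g (n ∸ d))
    ≡⟨ sym (∑-upTo-indicator d (λ k → c *ᶻ g (n ∸ k)) (suc n)) ⟩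
  ∑ (λ k → when (k ≡ᵇ d) (c *ᶻ g (n ∸ k))) (upTo (suc n))
    ≡⟨ ∑-cong (λ k → when-*ʳ (k ≡ᵇ d)) (upTo (suc n)) ⟩
  ∑ (λ k → coeffᵐ k (c , d) *ᶻ g (n ∸ k)) (upTo (suc n)) ∎
  where
  open ≡-Reasoning
  ≤ᵇ≡<ᵇ-suc : ∀ d → (d ≤ᵇ n) ≡ (d <ᵇ suc n)
  ≤ᵇ≡<ᵇ-suc zero = refl
  ≤ᵇ≡<ᵇ-suc (suc d) = refl
  when-*ʳ : ∀ {x y} b → when b (x *ᶻ y) ≡ when b x *ᶻ y
  when-*ʳ true = refl
  when-*ʳ {x} {y} false = sym (ℤP.*-zeroˡ y)

coeff-** : ∀ A B n → coeff (A ** B) n ≡ (coeff A ⊛ coeff B) n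
coeff-** A B n = begin
  coeff (A ** B) n
    ≡⟨ coeff-**-⊙ˢ A B n ⟩
  ∑ (λ u → (u ⊙ˢ coeff B) n) A
    ≡⟨ ∑-cong (λ u → ⊙ˢ-as-⊛ u (coeff B) n) A ⟩
  ∑ (λ u → ∑ (λ k → coeffᵐ k u *ᶻ coeff B (n ∸ k)) (upTo (suc n))) A
    ≡⟨ ∑-swap (λ u k → coeffᵐ k u *ᶻ coeff B (n ∸ k)) A (upTo (suc n)) ⟩
  ∑ (λ k → ∑ (λ u → coeffᵐ k u *ᶻ coeff B (n ∸ k)) A) (upTo (suc n))
    ≡⟨ ∑-cong (λ k → ∑-*ʳ (coeff B (n ∸ k)) (coeffᵐ k) A) (upTo (suc n)) ⟩
  (coeff A ⊛ coeff B) n ∎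
  where open ≡-Reasoning

coeff-**-comm : ∀ A B n → coeff (A ** B) n ≡ coeff (B ** A) n
coeff-**-comm A B n = begin
  coeff (A ** B) n
    ≡⟨ coeff-**-pairs A B n ⟩
  ∑ (λ u → ∑ (λ v → coeffᵐ n (u · v)) B) A
    ≡⟨ ∑-swap (λ u v → coeffᵐ n (u · v)) A B ⟩
  ∑ (λ v → ∑ (λ u → coeffᵐ n (u · v)) A) B
    ≡⟨ ∑-cong (λ v → ∑-cong (λ u → cong (coeffᵐ n) (·-comm u v)) A) B ⟩
  ∑ (λ v → ∑ (λ u → coeffᵐ n (v · u)) A) B
    ≡⟨ sym (coeff-**-pairs B A n) ⟩
  coeff (B ** A) n ∎
  where open ≡-Reasoning

coeff-**-assoc : ∀ A B C n → coeff (A ** B ** C) n ≡ coeff (A ** (B ** C)) n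
coeff-**-assoc A B C n = begin
  coeff (A ** B ** C) n
    ≡⟨ coeff-**-pairs (A ** B) C n ⟩
  ∑ (λ x → ∑ (λ w → coeffᵐ n (x · w)) C) (A ** B)
    ≡⟨ ∑-** _ A B ⟩
  ∑ (λ u → ∑ (λ v → ∑ (λ w → coeffᵐ n ((u · v) · w)) C) B) A
    ≡⟨ ∑-cong (λ u → ∑-cong (λ v → ∑-cong (λ w → cong (coeffᵐ n) (·-assoc u v w)) C) B) A ⟩
  ∑ (λ u → ∑ (λ v → ∑ (λ w → coeffᵐ n (u · (v · w))) C) B) A
    ≡⟨ ∑-cong (λ u → sym (∑-** (λ y → coeffᵐ n (u · y)) B C)) A ⟩
  ∑ (λ u → ∑ (λ y → coeffᵐ n (u · y)) (B ** C)) A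
    ≡⟨ sym (coeff-**-pairs A (B ** C) n) ⟩
  coeff (A ** (B ** C)) n ∎
  where open ≡-Reasoning

-- Truncated polynomial arithmetic

-- Equality in ℤ[q]/(q^(N+1)).
infix 4 _≈[_]_
record _≈[_]_ (A : Poly) (N : ℕ) (B : Poly) : Set where
  constructor mk≈
  field coeff-≡ : ∀ n → n ≤ N → coeff A n ≡ coeff B n
open _≈[_]_

≈-refl : ∀ {A N} → A ≈[ N ] A
≈-refl = mk≈ λ _ _ → refl

≈-sym : ∀ {A B N} → A ≈[ N ] B → B ≈[ N ] A
≈-sym A≈B = mk≈ λ n n≤N → sym (coeff-≡ A≈B n n≤N)

≈-trans : ∀ {A B C N} → A ≈[ N ] B → B ≈[ N ] C → A ≈[ N ] C
≈-trans A≈B B≈C = mk≈ λ n n≤N → trans (coeff-≡ A≈B n n≤N) (coeff-≡ B≈C n n≤N)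

≈-setoid : ℕ → Setoid _ _
≈-setoid N = record
  { Carrier = Poly
  ; _≈_ = _≈[ N ]_
  ; isEquivalence = record { refl = ≈-refl ; sym = ≈-sym ; trans = ≈-trans }
  }

module ≈-Reasoning {N : ℕ} = Relation.Binary.Reasoning.Setoid (≈-setoid N)

≡⇒≈ : ∀ {A B N} → A ≡ B → A ≈[ N ] B
≡⇒≈ refl = ≈-refl

coeffs⇒≈ : ∀ {A B N} → (∀ n → coeff A n ≡ coeff B n) → A ≈[ N ] B
coeffs⇒≈ A≗B = mk≈ λ n _ → A≗B n

≈[]-if-degrees-above : ∀ {N} A → All (λ u → N < proj₂ u) A → A ≈[ N ] []
≈[]-if-degrees-above [] [] = ≈-refl
≈[]-if-degrees-above {N} ((c , d) ∷ A) (N<d ∷ N<A) =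
  mk≈ λ n n≤N → cong₂ _+ᶻ_ (vanishes n n≤N) (coeff-≡ (≈[]-if-degrees-above A N<A) n n≤N)
  where
  vanishes : ∀ n → n ≤ N → coeffᵐ n (c , d) ≡ 0ℤ
  vanishes n n≤N rewrite ≡ᵇ-false {n} {d} (λ n≡d → ℕP.<-irrefl n≡d (ℕP.≤-<-trans n≤N N<d)) = refl

++-cong : ∀ {A A′ B B′ N} → A ≈[ N ] A′ → B ≈[ N ] B′ → A ++ B ≈[ N ] A′ ++ B′
++-cong {A} {A′} {B} {B′} A≈A′ B≈B′ = mk≈ λ n n≤N → begin
  coeff (A ++ B) n           ≡⟨ coeff-++ A B n ⟩
  coeff A n +ᶻ coeff B n     ≡⟨ cong₂ _+ᶻ_ (coeff-≡ A≈A′ n n≤N) (coeff-≡ B≈B′ n n≤N) ⟩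
  coeff A′ n +ᶻ coeff B′ n   ≡⟨ sym (coeff-++ A′ B′ n) ⟩
  coeff (A′ ++ B′) n         ∎
  where open ≡-Reasoning

++-identityʳ-≈ : ∀ A {N} → A ++ [] ≈[ N ] A
++-identityʳ-≈ A = ≡⇒≈ (LP.++-identityʳ A)

++-interchange : ∀ A B C D {N} → (A ++ B) ++ (C ++ D) ≈[ N ] (A ++ C) ++ (B ++ D)
++-interchange A B C D = coeffs⇒≈ λ n → begin
  coeff ((A ++ B) ++ (C ++ D)) n                          ≡⟨ split A B C D n ⟩
  (coeff A n +ᶻ coeff B n) +ᶻ (coeff C n +ᶻ coeff D n)    ≡⟨ +-interchange (coeff A n) (coeff B n) (coeff C n) (coeff D n) ⟩
  (coeff A n +ᶻ coeff C n) +ᶻ (coeff B n +ᶻ coeff D n)    ≡⟨ sym (split A C B D n) ⟩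
  coeff ((A ++ C) ++ (B ++ D)) n                          ∎
  where
  open ≡-Reasoning
  split : ∀ A B C D n → coeff ((A ++ B) ++ (C ++ D)) n ≡ (coeff A n +ᶻ coeff B n) +ᶻ (coeff C n +ᶻ coeff D n)
  split A B C D n = trans (coeff-++ (A ++ B) (C ++ D) n) (cong₂ _+ᶻ_ (coeff-++ A B n) (coeff-++ C D n))

⊙ˢ-cong : ∀ u {f g : Series} n → (∀ m → m ≤ n → f m ≡ g m) → (u ⊙ˢ f) n ≡ (u ⊙ˢ g) n
⊙ˢ-cong (c , d) n f≗g = cong (λ z → when (d ≤ᵇ n) (c *ᶻ z)) (f≗g (n ∸ d) (ℕP.m∸n≤m n d))

⊙-cong : ∀ u {A B N} → A ≈[ N ] B → u ⊙ A ≈[ N ] u ⊙ B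
⊙-cong u {A} {B} A≈B = mk≈ λ n n≤N →
  trans (coeff-⊙ u A n)
    (trans (⊙ˢ-cong u n (λ m m≤n → coeff-≡ A≈B m (ℕP.≤-trans m≤n n≤N))) (sym (coeff-⊙ u B n)))

⊙-congˡ : ∀ {u v} A {N} → u ≡ v → u ⊙ A ≈[ N ] v ⊙ A
⊙-congˡ A refl = ≈-refl

⊙-identityˡ : ∀ A {N} → 1ᵐ ⊙ A ≈[ N ] A
⊙-identityˡ A = coeffs⇒≈ λ n →
  trans (∑-map (coeffᵐ n) (1ᵐ ·_) A) (∑-cong (λ (c , d) → cong (λ z → coeffᵐ n (z , d)) (ℤP.*-identityˡ c)) A)

⊙-⊙ : ∀ u v A {N} → u ⊙ v ⊙ A ≈[ N ] (u · v) ⊙ A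
⊙-⊙ u v A = coeffs⇒≈ λ n → trans (∑-map (coeffᵐ n) (u ·_) (v ⊙ A)) (trans (∑-map _ (v ·_) A)
  (sym (trans (∑-map (coeffᵐ n) ((u · v) ·_) A) (∑-cong (λ w → cong (coeffᵐ n) (·-assoc u v w)) A))))

⊙-inverseʳ : ∀ u A {N} → u ⊙ A ++ negᵐ u ⊙ A ≈[ N ] []
⊙-inverseʳ u A = coeffs⇒≈ λ n → begin
  coeff (u ⊙ A ++ negᵐ u ⊙ A) n                  ≡⟨ coeff-++ (u ⊙ A) (negᵐ u ⊙ A) n ⟩
  coeff (u ⊙ A) n +ᶻ coeff (negᵐ u ⊙ A) n        ≡⟨ cong (coeff (u ⊙ A) n +ᶻ_) (coeff-negᵐ-⊙ {n} u) ⟩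
  coeff (u ⊙ A) n +ᶻ - coeff (u ⊙ A) n           ≡⟨ ℤP.+-inverseʳ (coeff (u ⊙ A) n) ⟩
  0ℤ                                             ∎
  where
  open ≡-Reasoning
  coeff-negᵐ-⊙ : ∀ {n} u → coeff (negᵐ u ⊙ A) n ≡ - coeff (u ⊙ A) n
  coeff-negᵐ-⊙ {n} (c , d) = trans (coeff-⊙ (- c , d) A n) (trans (neg-when (d ≤ᵇ n)) (cong -_ (sym (coeff-⊙ (c , d) A n))))
    where
    neg-when : ∀ b → when b (- c *ᶻ coeff A (n ∸ d)) ≡ - when b (c *ᶻ coeff A (n ∸ d))
    neg-when true = sym (ℤP.neg-distribˡ-* c _)
    neg-when false = refl

**-comm : ∀ A B {N} → A ** B ≈[ N ] B ** A
**-comm A B = coeffs⇒≈ (coeff-**-comm A B)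

**-assoc : ∀ A B C {N} → A ** B ** C ≈[ N ] A ** (B ** C)
**-assoc A B C = coeffs⇒≈ (coeff-**-assoc A B C)

**-congʳ : ∀ A {B B′ N} → B ≈[ N ] B′ → A ** B ≈[ N ] A ** B′
**-congʳ A {B} {B′} B≈B′ = mk≈ λ n n≤N →
  trans (coeff-**-⊙ˢ A B n)
    (trans (∑-cong (λ u → ⊙ˢ-cong u n (λ m m≤n → coeff-≡ B≈B′ m (ℕP.≤-trans m≤n n≤N))) A)
      (sym (coeff-**-⊙ˢ A B′ n)))

**-congˡ : ∀ {A A′} B {N} → A ≈[ N ] A′ → A ** B ≈[ N ] A′ ** B
**-congˡ {A} {A′} B A≈A′ = ≈-trans (**-comm A B) (≈-trans (**-congʳ B A≈A′) (**-comm B A′))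

**-cong : ∀ {A A′ B B′ N} → A ≈[ N ] A′ → B ≈[ N ] B′ → A ** B ≈[ N ] A′ ** B′
**-cong {A′ = A′} {B = B} A≈A′ B≈B′ = ≈-trans (**-congˡ B A≈A′) (**-congʳ A′ B≈B′)

[-]-** : ∀ u A {N} → (u ∷ []) ** A ≈[ N ] u ⊙ A
[-]-** u A = ++-identityʳ-≈ (u ⊙ A)

**-identityˡ : ∀ A {N} → (1ᵐ ∷ []) ** A ≈[ N ] A
**-identityˡ A = ≈-trans ([-]-** 1ᵐ A) (⊙-identityˡ A)

coupled-elimination : ∀ {N} F G F′ G′ a b → F′ ≈[ N ] F ++ a ⊙ G′ → G′ ≈[ N ] G ++ b ⊙ F′ →
  F′ ++ negᵐ (a · b) ⊙ F′ ≈[ N ] F ++ a ⊙ G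
coupled-elimination F G F′ G′ a b F′≈ G′≈ = begin
  F′ ++ −abF′
    ≈⟨ ++-cong F′≈ ≈-refl ⟩
  (F ++ a ⊙ G′) ++ −abF′
    ≈⟨ ++-cong (++-cong {A = F} ≈-refl (⊙-cong a G′≈)) ≈-refl ⟩
  (F ++ a ⊙ (G ++ b ⊙ F′)) ++ −abF′
    ≡⟨ cong (λ H → (F ++ H) ++ −abF′) (⊙-distrib-++ a G (b ⊙ F′)) ⟩
  (F ++ (a ⊙ G ++ a ⊙ b ⊙ F′)) ++ −abF′
    ≈⟨ ++-cong (++-cong {A = F} ≈-refl (++-cong {A = a ⊙ G} ≈-refl (⊙-⊙ a b F′))) ≈-refl ⟩
  (F ++ (a ⊙ G ++ (a · b) ⊙ F′)) ++ −abF′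
    ≡⟨ LP.++-assoc F _ −abF′ ⟩
  F ++ ((a ⊙ G ++ (a · b) ⊙ F′) ++ −abF′)
    ≡⟨ cong (F ++_) (LP.++-assoc (a ⊙ G) ((a · b) ⊙ F′) −abF′) ⟩
  F ++ (a ⊙ G ++ ((a · b) ⊙ F′ ++ −abF′))
    ≈⟨ ++-cong {A = F} ≈-refl (++-cong {A = a ⊙ G} ≈-refl (⊙-inverseʳ (a · b) F′)) ⟩
  F ++ (a ⊙ G ++ [])
    ≡⟨ cong (F ++_) (LP.++-identityʳ (a ⊙ G)) ⟩
  F ++ a ⊙ G ∎
  where
  open ≈-Reasoning
  −abF′ = negᵐ (a · b) ⊙ F′

-- Cancelling 1 + y with deg y ≥ 1: coefficient m of X is determined by coefficient m of
-- X (1 + y) and the lower coefficients of X.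
1+-cancelʳ : ∀ {N} X Y y → 1 ≤ proj₂ y → X ++ y ⊙ X ≈[ N ] Y ++ y ⊙ Y → X ≈[ N ] Y
1+-cancelʳ {N} X Y (c , d) 1≤d X+yX≈Y+yY = mk≈ λ n → <-rec (λ m → m ≤ N → coeff X m ≡ coeff Y m) step n
  where
  shifted : ∀ m → (∀ {j} → j < m → j ≤ N → coeff X j ≡ coeff Y j) → m ≤ N →
    ((c , d) ⊙ˢ coeff X) m ≡ ((c , d) ⊙ˢ coeff Y) m
  shifted m ih m≤N with d ℕP.≤? m
  ... | yes d≤m = cong (λ z → when (d ≤ᵇ m) (c *ᶻ z))
                       (ih (ℕP.∸-monoʳ-< {m} {d} {0} 1≤d d≤m) (ℕP.≤-trans (ℕP.m∸n≤m m d) m≤N))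
  ... | no d≰m rewrite ≤ᵇ-false {d} {m} (ℕP.≰⇒> d≰m) = refl
  step : ∀ m → (∀ {j} → j < m → j ≤ N → coeff X j ≡ coeff Y j) → m ≤ N → coeff X m ≡ coeff Y m
  step m ih m≤N = ∙-cancelʳ (((c , d) ⊙ˢ coeff X) m) (coeff X m) (coeff Y m) (begin
    coeff X m +ᶻ ((c , d) ⊙ˢ coeff X) m
      ≡⟨ sym (trans (coeff-++ X _ m) (cong (coeff X m +ᶻ_) (coeff-⊙ (c , d) X m))) ⟩
    coeff (X ++ (c , d) ⊙ X) m
      ≡⟨ coeff-≡ X+yX≈Y+yY m m≤N ⟩
    coeff (Y ++ (c , d) ⊙ Y) m
      ≡⟨ trans (coeff-++ Y _ m) (cong (coeff Y m +ᶻ_) (coeff-⊙ (c , d) Y m)) ⟩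
    coeff Y m +ᶻ ((c , d) ⊙ˢ coeff Y) m
      ≡⟨ cong (coeff Y m +ᶻ_) (sym (shifted m ih m≤N)) ⟩
    coeff Y m +ᶻ ((c , d) ⊙ˢ coeff X) m ∎)
    where open ≡-Reasoning

-- Power series

one≡coeff-1ᵐ : ∀ n → one n ≡ coeff (1ᵐ ∷ []) n
one≡coeff-1ᵐ zero = refl
one≡coeff-1ᵐ (suc n) = refl

⊛-cong : ∀ {f f′ g g′ : Series} n → (∀ k → k ≤ n → f k ≡ f′ k) → (∀ k → k ≤ n → g k ≡ g′ k) →
  (f ⊛ g) n ≡ (f′ ⊛ g′) n
⊛-cong n f≗f′ g≗g′ =
  ∑-upTo-cong (suc n) (λ k k<1+n → cong₂ _*ᶻ_ (f≗f′ k (ℕP.≤-pred k<1+n)) (g≗g′ (n ∸ k) (ℕP.m∸n≤m n k)))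

∏ : (ℕ → Poly) → List ℕ → Poly
∏ F is = foldr (λ i P → F i ** P) (1ᵐ ∷ []) is

prodUpTo≡coeff-∏ : (F : ℕ → Series) (F′ : ℕ → Poly) → (∀ i n → F i n ≡ coeff (F′ i) n) →
  ∀ is n → foldr (λ i P → F i ⊛ P) one is n ≡ coeff (∏ F′ is) n
prodUpTo≡coeff-∏ F F′ F≗F′ [] n = one≡coeff-1ᵐ n
prodUpTo≡coeff-∏ F F′ F≗F′ (i ∷ is) n =
  trans (⊛-cong n (λ k _ → F≗F′ i k) (λ k _ → prodUpTo≡coeff-∏ F F′ F≗F′ is k)) (sym (coeff-** (F′ i) (∏ F′ is) n))

∏-∷ʳ : ∀ F is j {N} → ∏ F (is ++ j ∷ []) ≈[ N ] ∏ F is ** F j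
∏-∷ʳ F [] j = **-comm (F j) (1ᵐ ∷ [])
∏-∷ʳ F (i ∷ is) j = ≈-trans (**-congʳ (F i) (∏-∷ʳ F is j)) (≈-sym (**-assoc (F i) (∏ F is) (F j)))

∏-upTo-suc : ∀ F k {N} → ∏ F (upTo (suc k)) ≈[ N ] ∏ F (upTo k) ** F k
∏-upTo-suc F k = ≈-trans (≡⇒≈ (cong (∏ F) (sym (LP.upTo-∷ʳ k)))) (∏-∷ʳ F (upTo k) k)

pochFactorPoly : ℤ → ℕ → ℤ → ℕ → ℕ → Poly
pochFactorPoly c d c′ e i = 1ᵐ ∷ (- (c *ᶻ (c′ ^ᶻ i)) , d + e * i) ∷ []

pochFactor≡coeff : ∀ c d c′ e i n → pochFactor c d c′ e i n ≡ coeff (pochFactorPoly c d c′ e i) n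
pochFactor≡coeff c d c′ e i zero with 0 ≡ᵇ d + e * i
... | true = lemma (c *ᶻ (c′ ^ᶻ i))
  where
  lemma : ∀ x → 1ℤ +ᶻ - x ≡ 1ℤ +ᶻ (- x +ᶻ 0ℤ)
  lemma = ℤ-Solver.solve-∀
... | false = refl
pochFactor≡coeff c d c′ e i (suc n) with suc n ≡ᵇ d + e * i
... | true = lemma (c *ᶻ (c′ ^ᶻ i))
  where
  lemma : ∀ x → 0ℤ +ᶻ - x ≡ 0ℤ +ᶻ (- x +ᶻ 0ℤ)
  lemma = ℤ-Solver.solve-∀
... | false = refl

poch∞≡coeff-∏ : ∀ c d c′ e N → poch∞ c d c′ e N ≡ coeff (∏ (pochFactorPoly c d c′ e) (upTo (suc N))) N
poch∞≡coeff-∏ c d c′ e N =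
  prodUpTo≡coeff-∏ (pochFactor c d c′ e) (pochFactorPoly c d c′ e) (pochFactor≡coeff c d c′ e) (upTo (suc N)) N

invRev≡map-recip : ∀ a n → invRev a n ≡ map (λ k → recip a (n ∸ k)) (upTo (suc n))
invRev≡map-recip a zero = refl
invRev≡map-recip a (suc n) = cong (recip a (suc n) ∷_) (begin
  invRev a n
    ≡⟨ invRev≡map-recip a n ⟩
  map (λ k → recip a (n ∸ k)) (upTo (suc n))
    ≡⟨ LP.map-upTo (λ k → recip a (n ∸ k)) (suc n) ⟩
  applyUpTo (λ k → recip a (n ∸ k)) (suc n)
    ≡⟨ sym (LP.map-applyUpTo suc (λ k → recip a (suc n ∸ k)) (suc n)) ⟩
  map (λ k → recip a (suc n ∸ k)) (applyUpTo suc (suc n)) ∎)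
  where open ≡-Reasoning

recip-suc : ∀ a n → recip a (suc n) ≡ - ∑ (λ k → a (suc k) *ᶻ recip a (n ∸ k)) (upTo (suc n))
recip-suc a n = trans
  (cong (λ bs → - sumℤ (zipWith _*ᶻ_ (map (λ k → a (suc k)) (upTo (suc n))) bs)) (invRev≡map-recip a n))
  (cong (-_ ∘ sumℤ) (zipWith-diag (λ k → a (suc k)) (λ k → recip a (n ∸ k)) (upTo (suc n))))
  where
  zipWith-diag : (f g : X → ℤ) (xs : List X) → zipWith _*ᶻ_ (map f xs) (map g xs) ≡ map (λ x → f x *ᶻ g x) xs
  zipWith-diag f g [] = refl
  zipWith-diag f g (x ∷ xs) = cong (_ ∷_) (zipWith-diag f g xs)

⊛-suc : ∀ (a c : Series) n → (a ⊛ c) (suc n) ≡ a 0 *ᶻ c (suc n) +ᶻ ∑ (λ k → a (suc k) *ᶻ c (n ∸ k)) (upTo (suc n))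
⊛-suc a c n = cong (a 0 *ᶻ c (suc n) +ᶻ_)
  (trans (cong (∑ (λ k → a k *ᶻ c (suc n ∸ k))) (sym (LP.map-upTo suc (suc n)))) (∑-map (λ k → a k *ᶻ c (suc n ∸ k)) suc (upTo (suc n))))

⊛-recip : ∀ (a : Series) → a 0 ≡ 1ℤ → ∀ n → (a ⊛ recip a) n ≡ one n
⊛-recip a a0≡1 zero = cong (λ z → z *ᶻ 1ℤ +ᶻ 0ℤ) a0≡1
⊛-recip a a0≡1 (suc n) = begin
  (a ⊛ recip a) (suc n)            ≡⟨ ⊛-suc a (recip a) n ⟩
  a 0 *ᶻ recip a (suc n) +ᶻ S      ≡⟨ cong₂ (λ z w → z *ᶻ w +ᶻ S) a0≡1 (recip-suc a n) ⟩
  1ℤ *ᶻ (- S) +ᶻ S                 ≡⟨ lemma S ⟩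
  0ℤ                               ∎
  where
  open ≡-Reasoning
  S = ∑ (λ k → a (suc k) *ᶻ recip a (n ∸ k)) (upTo (suc n))
  lemma : ∀ S → 1ℤ *ᶻ (- S) +ᶻ S ≡ 0ℤ
  lemma = ℤ-Solver.solve-∀

recip-unique : ∀ (a c : Series) N → a 0 ≡ 1ℤ → (∀ n → n ≤ N → (a ⊛ c) n ≡ one n) →
  ∀ n → n ≤ N → c n ≡ recip a n
recip-unique a c N a0≡1 ac≡1 = <-rec (λ n → n ≤ N → c n ≡ recip a n) step
  where
  step : ∀ n → (∀ {m} → m < n → m ≤ N → c m ≡ recip a m) → n ≤ N → c n ≡ recip a n
  step zero _ _ = trans (lemma (c 0)) (trans (cong (λ z → z *ᶻ c 0 +ᶻ 0ℤ) (sym a0≡1)) (ac≡1 0 z≤n))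
    where
    lemma : ∀ x → x ≡ 1ℤ *ᶻ x +ᶻ 0ℤ
    lemma = ℤ-Solver.solve-∀
  step (suc n) ih 1+n≤N = begin
    c (suc n)
      ≡⟨ lemma (c (suc n)) S ⟩
    (1ℤ *ᶻ c (suc n) +ᶻ S) +ᶻ - S
      ≡⟨ cong (λ z → (z *ᶻ c (suc n) +ᶻ S) +ᶻ - S) (sym a0≡1) ⟩
    (a 0 *ᶻ c (suc n) +ᶻ S) +ᶻ - S
      ≡⟨ cong (_+ᶻ - S) (trans (sym (⊛-suc a c n)) (ac≡1 (suc n) 1+n≤N)) ⟩
    0ℤ +ᶻ - S
      ≡⟨ ℤP.+-identityˡ _ ⟩
    - S
      ≡⟨ cong -_ (∑-upTo-cong (suc n) (λ k _ → cong (a (suc k) *ᶻ_) (ih′ (n ∸ k) (ℕP.m∸n≤m n k)))) ⟩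
    - ∑ (λ k → a (suc k) *ᶻ recip a (n ∸ k)) (upTo (suc n))
      ≡⟨ sym (recip-suc a n) ⟩
    recip a (suc n) ∎
    where
    open ≡-Reasoning
    S = ∑ (λ k → a (suc k) *ᶻ c (n ∸ k)) (upTo (suc n))
    ih′ : ∀ m → m ≤ n → c m ≡ recip a m
    ih′ m m≤n = ih (s≤s m≤n) (ℕP.≤-trans (ℕP.m≤n⇒m≤1+n m≤n) 1+n≤N)
    lemma : ∀ x S → x ≡ (1ℤ *ᶻ x +ᶻ S) +ᶻ - S
    lemma = ℤ-Solver.solve-∀

recip-vanishes-off-multiples : ∀ (a : Series) R → a 0 ≡ 1ℤ → (∀ k → ¬ R ∣ k → a k ≡ 0ℤ) →
  ∀ n → ¬ R ∣ n → recip a n ≡ 0ℤ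
recip-vanishes-off-multiples a R a0≡1 a-off n R∤n =
  trans (sym (recip-unique a b n a0≡1 (λ m _ → a⊛b≡one m (R ∣? m)) n ℕP.≤-refl)) (b-off R∤n)
  where
  b : Series
  b m = when (does (R ∣? m)) (recip a m)
  b-off : ∀ {m} → ¬ R ∣ m → b m ≡ 0ℤ
  b-off {m} R∤m with R ∣? m
  ... | yes R∣m = ⊥-elim (R∤m R∣m)
  ... | no _ = refl
  b-on : ∀ {m} → R ∣ m → b m ≡ recip a m
  b-on {m} R∣m with R ∣? m
  ... | yes _ = refl
  ... | no R∤m = ⊥-elim (R∤m R∣m)
  -- a k b (m - k) = a k recip (m - k) if R ∣ m, and 0 otherwise, since a k = 0 unless R ∣ k.
  a⊛b≡one : ∀ m → Dec (R ∣ m) → (a ⊛ b) m ≡ one m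
  a⊛b≡one m (yes R∣m) = trans (∑-upTo-cong (suc m) term) (⊛-recip a a0≡1 m)
    where
    term : ∀ k → k < suc m → a k *ᶻ b (m ∸ k) ≡ a k *ᶻ recip a (m ∸ k)
    term k k<1+m with R ∣? k
    ... | yes R∣k = cong (a k *ᶻ_) (b-on (∣m+n∣m⇒∣n (subst (R ∣_) (sym (ℕP.m+[n∸m]≡n (ℕP.≤-pred k<1+m))) R∣m) R∣k))
    ... | no R∤k rewrite a-off k R∤k = refl
  a⊛b≡one m (no R∤m) = trans (∑-upTo-cong (suc m) term) (trans (∑-zero (upTo (suc m))) (one-off m R∤m))
    where
    term : ∀ k → k < suc m → a k *ᶻ b (m ∸ k) ≡ 0ℤ
    term k k<1+m with R ∣? k
    ... | yes R∣k = trans (cong (a k *ᶻ_) (b-off λ R∣m∸k → R∤m (subst (R ∣_) (ℕP.m+[n∸m]≡n (ℕP.≤-pred k<1+m)) (∣m∣n⇒∣m+n R∣k R∣m∸k))))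
                          (ℤP.*-zeroʳ (a k))
    ... | no R∤k rewrite a-off k R∤k = refl
    one-off : ∀ m → ¬ R ∣ m → 0ℤ ≡ one m
    one-off zero R∤0 = ⊥-elim (R∤0 (divides 0 refl))
    one-off (suc m) _ = refl

DegreesDivisibleBy : ℕ → Poly → Set
DegreesDivisibleBy R = All (λ u → R ∣ proj₂ u)

⊙-degreesDivisibleBy : ∀ {R} u A → R ∣ proj₂ u → DegreesDivisibleBy R A → DegreesDivisibleBy R (u ⊙ A)
⊙-degreesDivisibleBy u [] _ _ = []
⊙-degreesDivisibleBy u (v ∷ A) R∣u (R∣v ∷ R∣A) = ∣m∣n⇒∣m+n R∣u R∣v ∷ ⊙-degreesDivisibleBy u A R∣u R∣A

**-degreesDivisibleBy : ∀ {R} A B → DegreesDivisibleBy R A → DegreesDivisibleBy R B → DegreesDivisibleBy R (A ** B)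
**-degreesDivisibleBy [] B _ _ = []
**-degreesDivisibleBy (u ∷ A) B (R∣u ∷ R∣A) R∣B =
  AllP.++⁺ (⊙-degreesDivisibleBy u B R∣u R∣B) (**-degreesDivisibleBy A B R∣A R∣B)

∏-degreesDivisibleBy : ∀ {R} F → (∀ i → DegreesDivisibleBy R (F i)) → ∀ is → DegreesDivisibleBy R (∏ F is)
∏-degreesDivisibleBy F R∣F [] = divides 0 refl ∷ []
∏-degreesDivisibleBy F R∣F (i ∷ is) = **-degreesDivisibleBy (F i) _ (R∣F i) (∏-degreesDivisibleBy F R∣F is)

coeff-off-multiples : ∀ {R} A n → DegreesDivisibleBy R A → ¬ R ∣ n → coeff A n ≡ 0ℤ
coeff-off-multiples [] n _ _ = refl
coeff-off-multiples {R} ((c , d) ∷ A) n (R∣d ∷ R∣A) R∤n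
  rewrite ≡ᵇ-false {n} {d} (λ n≡d → R∤n (subst (R ∣_) (sym n≡d) R∣d)) =
  trans (ℤP.+-identityˡ _) (coeff-off-multiples A n R∣A R∤n)

-- Partitions

∑-sameMembers : (f : X → ℤ) (xs ys : List X) → Unique xs → Unique ys → (∀ x → x ∈ xs ⇔ x ∈ ys) →
  ∑ f xs ≡ ∑ f ys
∑-sameMembers f xs ys xs! ys! xs⇔ys =
  ↭ₛ.foldr-commMonoid ℤP.+-0-isCommutativeMonoid (↭⇒↭ₛ (↭P.map⁺ f (∼bag⇒↭ (unique∧set⇒bag xs! ys! (xs⇔ys _)))))

∑-filter : (f : X → ℤ) (g : X → ℕ) (N : ℕ) (xs : List X) →
  ∑ f (filter (λ x → g x ℕ.≟ N) xs) ≡ ∑ (λ x → when (N ≡ᵇ g x) (f x)) xs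
∑-filter f g N [] = refl
∑-filter f g N (x ∷ xs) with g x ≡ᵇ N in gx≡ᵇN
... | true rewrite ℕP.≡ᵇ⇒≡ (g x) N (subst T (sym gx≡ᵇN) _) | ≡ᵇ-refl N = cong (f x +ᶻ_) (∑-filter f g N xs)
... | false rewrite ≡ᵇ-false {N} {g x} (λ N≡gx → subst T gx≡ᵇN (ℕP.≡⇒≡ᵇ (g x) N (sym N≡gx))) =
  trans (∑-filter f g N xs) (sym (ℤP.+-identityˡ _))

disjoint-by : ∀ {xs ys : List X} (P : X → Set) → (∀ {v} → v ∈ xs → P v) → (∀ {v} → v ∈ ys → ¬ P v) → Disjoint xs ys
disjoint-by P xs⊆P ys⊆¬P (v∈xs , v∈ys) = ys⊆¬P v∈ys (xs⊆P v∈xs)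

below-head : ∀ {x xs} → Linked _>_ (x ∷ xs) → All (_< x) xs
below-head lk = AllPairs.head (Linked⇒AllPairs (λ x>y y>z → ℕP.<-trans y>z x>y) lk)

atMost-head : ∀ {x xs} → Linked _≥_ (x ∷ xs) → All (_≤ x) xs
atMost-head lk = AllPairs.head (Linked⇒AllPairs (λ x≥y y≥z → ℕP.≤-trans y≥z x≥y) lk)

closed-under-lengthening⇒empty : (grow : List X → List X) → (∀ π → length π < length (grow π)) →
  ∀ (Π : List (List X)) → (∀ {π} → π ∈ Π → grow π ∈ Π) → ∀ {π} → ¬ π ∈ Π
closed-under-lengthening⇒empty grow longer (π₀ ∷ Π) closed _ =
  ℕP.<⇒≱ (longer longest) (All.lookup lengths≤ (closed longest∈))
  where
  open Extrema ℕP.≤-totalOrder using (argmax; argmax-all; f[⊥]≤f[argmax]; f[xs]≤f[argmax])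
  longest = argmax length π₀ Π
  longest∈ : longest ∈ π₀ ∷ Π
  longest∈ = argmax-all length (here refl) (All.tabulate there)
  lengths≤ : All (λ π → length π ≤ length longest) (π₀ ∷ Π)
  lengths≤ = f[⊥]≤f[argmax] {f = length} π₀ Π ∷ f[xs]≤f[argmax] {f = length} π₀ Π

distinctUpTo : ℕ → List (List ℕ)
distinctUpTo zero = [] ∷ []
distinctUpTo (suc m) = distinctUpTo m ++ map (suc m ∷_) (distinctUpTo m)

distinctUpTo-sound : ∀ m {π} → π ∈ distinctUpTo m → IsDistinctPartition π × All (_≤ m) π
distinctUpTo-sound zero (here refl) = ([] , []) , []
distinctUpTo-sound (suc m) π∈ with ∈-++⁻ (distinctUpTo m) π∈
... | inj₁ π∈′ = let (π-ok , π≤m) = distinctUpTo-sound m π∈′ in π-ok , All.map ℕP.m≤n⇒m≤1+n π≤m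
... | inj₂ π∈′ with ∈-map⁻ (suc m ∷_) π∈′
... | ρ , ρ∈ , refl with distinctUpTo-sound m ρ∈
... | (ρ-pos , ρ-lk) , ρ≤m = (s≤s z≤n ∷ ρ-pos , cons ρ ρ-lk ρ≤m) , (ℕP.≤-refl ∷ All.map ℕP.m≤n⇒m≤1+n ρ≤m)
  where
  cons : ∀ ρ → Linked _>_ ρ → All (_≤ m) ρ → Linked _>_ (suc m ∷ ρ)
  cons [] _ _ = [-]
  cons (y ∷ ys) lk (y≤m ∷ _) = s≤s y≤m ∷ lk

distinctUpTo-complete : ∀ m {π} → IsDistinctPartition π → All (_≤ m) π → π ∈ distinctUpTo m
distinctUpTo-complete zero {[]} _ _ = here refl
distinctUpTo-complete zero {x ∷ xs} (0<x ∷ _ , _) (x≤0 ∷ _) = ⊥-elim (ℕP.<⇒≱ 0<x x≤0)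
distinctUpTo-complete (suc m) {[]} π-ok _ = ∈-++⁺ˡ (distinctUpTo-complete m π-ok [])
distinctUpTo-complete (suc m) {x ∷ xs} (0<x ∷ xs-pos , lk) (x≤1+m ∷ _) with x ℕ.≟ suc m
... | yes refl = ∈-++⁺ʳ (distinctUpTo m)
  (∈-map⁺ (suc m ∷_) (distinctUpTo-complete m (xs-pos , Linked.tail lk) (All.map ℕP.≤-pred (below-head lk))))
... | no x≢1+m = ∈-++⁺ˡ (distinctUpTo-complete m (0<x ∷ xs-pos , lk)
  (x≤m ∷ All.map (λ y<x → ℕP.≤-pred (ℕP.<-≤-trans y<x (ℕP.m≤n⇒m≤1+n x≤m))) (below-head lk)))
  where
  x≤m = ℕP.≤-pred (ℕP.≤∧≢⇒< x≤1+m x≢1+m)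

distinctUpTo-unique : ∀ m → Unique (distinctUpTo m)
distinctUpTo-unique zero = [] AllPairs.∷ AllPairs.[]
distinctUpTo-unique (suc m) =
  Unique.++⁺ (distinctUpTo-unique m) (Unique.map⁺ LP.∷-injectiveʳ (distinctUpTo-unique m))
    (disjoint-by (All (_≤ m)) (proj₂ ∘ distinctUpTo-sound m) ∉)
  where
  ∉ : ∀ {v} → v ∈ map (suc m ∷_) (distinctUpTo m) → ¬ All (_≤ m) v
  ∉ v∈ v≤m with ∈-map⁻ (suc m ∷_) v∈
  ∉ v∈ (1+m≤m ∷ _) | _ , _ , refl = ℕP.<-irrefl refl 1+m≤m

partitionsUpTo : ℕ → ℕ → List (List ℕ)
partitionsUpTo m zero = [] ∷ []
partitionsUpTo zero (suc ℓ) = []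
partitionsUpTo (suc m) (suc ℓ) = partitionsUpTo m (suc ℓ) ++ map (suc m ∷_) (partitionsUpTo (suc m) ℓ)

partitionsUpTo-sound : ∀ m ℓ {π} → π ∈ partitionsUpTo m ℓ → IsPartition π × All (_≤ m) π × length π ≡ ℓ
partitionsUpTo-sound m zero (here refl) = ([] , []) , [] , refl
partitionsUpTo-sound (suc m) (suc ℓ) π∈ with ∈-++⁻ (partitionsUpTo m (suc ℓ)) π∈
... | inj₁ π∈′ = let (π-ok , π≤m , len) = partitionsUpTo-sound m (suc ℓ) π∈′ in π-ok , All.map ℕP.m≤n⇒m≤1+n π≤m , len
... | inj₂ π∈′ with ∈-map⁻ (suc m ∷_) π∈′
... | ρ , ρ∈ , refl with partitionsUpTo-sound (suc m) ℓ ρ∈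
... | (ρ-pos , ρ-lk) , ρ≤1+m , refl = (s≤s z≤n ∷ ρ-pos , cons ρ ρ-lk ρ≤1+m) , (ℕP.≤-refl ∷ ρ≤1+m) , refl
  where
  cons : ∀ ρ → Linked _≥_ ρ → All (_≤ suc m) ρ → Linked _≥_ (suc m ∷ ρ)
  cons [] _ _ = [-]
  cons (y ∷ ys) lk (y≤1+m ∷ _) = y≤1+m ∷ lk

partitionsUpTo-∷ : ∀ m x {xs ℓ} → 0 < x → x ≤ m → xs ∈ partitionsUpTo x ℓ → (x ∷ xs) ∈ partitionsUpTo m (suc ℓ)
partitionsUpTo-∷ zero x 0<x x≤0 _ = ⊥-elim (ℕP.<⇒≱ 0<x x≤0)
partitionsUpTo-∷ (suc m) x {xs} {ℓ} 0<x x≤1+m xs∈ with x ℕ.≟ suc m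
... | yes refl = ∈-++⁺ʳ (partitionsUpTo m (suc ℓ)) (∈-map⁺ (suc m ∷_) xs∈)
... | no x≢1+m = ∈-++⁺ˡ (partitionsUpTo-∷ m x 0<x (ℕP.≤-pred (ℕP.≤∧≢⇒< x≤1+m x≢1+m)) xs∈)

partitionsUpTo-complete : ∀ m {π} → IsPartition π → All (_≤ m) π → π ∈ partitionsUpTo m (length π)
partitionsUpTo-complete m {[]} _ _ = here refl
partitionsUpTo-complete m {x ∷ xs} (0<x ∷ xs-pos , lk) (x≤m ∷ _) =
  partitionsUpTo-∷ m x 0<x x≤m (partitionsUpTo-complete x (xs-pos , Linked.tail lk) (atMost-head lk))

partitionsUpTo-unique : ∀ m ℓ → Unique (partitionsUpTo m ℓ)
partitionsUpTo-unique m zero = [] AllPairs.∷ AllPairs.[]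
partitionsUpTo-unique zero (suc ℓ) = AllPairs.[]
partitionsUpTo-unique (suc m) (suc ℓ) =
  Unique.++⁺ (partitionsUpTo-unique m (suc ℓ)) (Unique.map⁺ LP.∷-injectiveʳ (partitionsUpTo-unique (suc m) ℓ))
    (disjoint-by (All (_≤ m)) (proj₁ ∘ proj₂ ∘ partitionsUpTo-sound m (suc ℓ)) ∉)
  where
  ∉ : ∀ {v} → v ∈ map (suc m ∷_) (partitionsUpTo (suc m) ℓ) → ¬ All (_≤ m) v
  ∉ v∈ v≤m with ∈-map⁻ (suc m ∷_) v∈
  ∉ v∈ (1+m≤m ∷ _) | _ , _ , refl = ℕP.<-irrefl refl 1+m≤m

shortPartitionsUpTo : ℕ → ℕ → List (List ℕ)
shortPartitionsUpTo m zero = []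
shortPartitionsUpTo m (suc L) = partitionsUpTo m L ++ shortPartitionsUpTo m L

shortPartitionsUpTo-sound : ∀ m L {π} → π ∈ shortPartitionsUpTo m L → IsPartition π × All (_≤ m) π × length π < L
shortPartitionsUpTo-sound m (suc L) π∈ with ∈-++⁻ (partitionsUpTo m L) π∈
... | inj₁ π∈′ = let (π-ok , π≤m , len) = partitionsUpTo-sound m L π∈′ in π-ok , π≤m , ℕP.≤-reflexive (cong suc len)
... | inj₂ π∈′ = let (π-ok , π≤m , len) = shortPartitionsUpTo-sound m L π∈′ in π-ok , π≤m , ℕP.m≤n⇒m≤1+n len

shortPartitionsUpTo-complete : ∀ m L {π} → IsPartition π → All (_≤ m) π → length π < L → π ∈ shortPartitionsUpTo m L
shortPartitionsUpTo-complete m (suc L) {π} π-ok π≤m len<1+L with length π ℕ.≟ L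
... | yes refl = ∈-++⁺ˡ (partitionsUpTo-complete m π-ok π≤m)
... | no len≢L = ∈-++⁺ʳ (partitionsUpTo m L)
  (shortPartitionsUpTo-complete m L π-ok π≤m (ℕP.≤∧≢⇒< (ℕP.≤-pred len<1+L) len≢L))

shortPartitionsUpTo-unique : ∀ m L → Unique (shortPartitionsUpTo m L)
shortPartitionsUpTo-unique m zero = AllPairs.[]
shortPartitionsUpTo-unique m (suc L) = Unique.++⁺ (partitionsUpTo-unique m L) (shortPartitionsUpTo-unique m L)
  (disjoint-by (λ π → length π ≡ L) (proj₂ ∘ proj₂ ∘ partitionsUpTo-sound m L)
    (λ π∈ len≡L → ℕP.<-irrefl len≡L (proj₂ (proj₂ (shortPartitionsUpTo-sound m L π∈)))))

shortPartitionsUpTo-zero : ∀ L → shortPartitionsUpTo 0 (suc L) ≡ [] ∷ []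
shortPartitionsUpTo-zero zero = refl
shortPartitionsUpTo-zero (suc L) = shortPartitionsUpTo-zero L

double : ℕ → ℕ
double zero = zero
double (suc k) = suc (suc (double k))

⌊double/2⌋ : ∀ k → ⌊ double k /2⌋ ≡ k
⌊double/2⌋ zero = refl
⌊double/2⌋ (suc k) = cong suc (⌊double/2⌋ k)

⌊1+double/2⌋ : ∀ k → ⌊ suc (double k) /2⌋ ≡ k
⌊1+double/2⌋ zero = refl
⌊1+double/2⌋ (suc k) = cong suc (⌊1+double/2⌋ k)

≤1+double⌊/2⌋ : ∀ x → x ≤ suc (double ⌊ x /2⌋)
≤1+double⌊/2⌋ zero = z≤n
≤1+double⌊/2⌋ (suc zero) = s≤s z≤n
≤1+double⌊/2⌋ (suc (suc x)) = s≤s (s≤s (≤1+double⌊/2⌋ x))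

double-mono-≤ : ∀ {a b} → a ≤ b → double a ≤ double b
double-mono-≤ {zero} _ = z≤n
double-mono-≤ {suc a} {suc b} (s≤s a≤b) = s≤s (s≤s (double-mono-≤ a≤b))

double-cancel-≤ : ∀ {a b} → double a ≤ double b → a ≤ b
double-cancel-≤ {zero} _ = z≤n
double-cancel-≤ {suc a} {suc b} (s≤s (s≤s a≤b)) = s≤s (double-cancel-≤ a≤b)

-- A partition with ℓ parts has ⌈ℓ/2⌉ odd-indexed and ⌊ℓ/2⌋ even-indexed parts, each
-- contributing at least 1 to ⌈O⌉ resp. ⌈E⌉.
length≤double⌈O⌉ : ∀ {π} → All (0 <_) π → length π ≤ double (⌈O⌉ π)
length≤1+double⌈E⌉ : ∀ {π} → All (0 <_) π → length π ≤ suc (double (⌈E⌉ π))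
length≤double⌈O⌉ {[]} _ = z≤n
length≤double⌈O⌉ {suc x ∷ xs} (_ ∷ xs-pos) =
  s≤s (ℕP.≤-trans (length≤1+double⌈E⌉ xs-pos) (s≤s (double-mono-≤ (ℕP.m≤n+m (⌈E⌉ xs) ⌊ x /2⌋))))
length≤1+double⌈E⌉ {[]} _ = z≤n
length≤1+double⌈E⌉ {x ∷ xs} (_ ∷ xs-pos) = s≤s (length≤double⌈O⌉ xs-pos)

module WeightedPartitions (r t s : ℕ) (ε : ℤ) where

  R : ℕ
  R = r + t + s

  oddPartWeight evenPartWeight : ℕ → Monomial
  oddPartWeight x = (1ℤ , r * ⌈ x /2⌉ + t * ⌊ x /2⌋)
  evenPartWeight x = ((-1ℤ ^ᶻ ⌈ x /2⌉) *ᶻ (ε ^ᶻ ⌊ x /2⌋) , s * ⌊ x /2⌋)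

  -- The weight of a list of parts whose first part has odd, resp. even, index in the partition.
  weightᵒ weightᵉ : List ℕ → Monomial
  weightᵒ [] = 1ᵐ
  weightᵒ (x ∷ xs) = oddPartWeight x · weightᵉ xs
  weightᵉ [] = 1ᵐ
  weightᵉ (x ∷ xs) = evenPartWeight x · weightᵒ xs

  1ᵐ≡weight-[] : 1ᵐ ≡ (1ℤ , r * 0 + t * 0 + s * 0)
  1ᵐ≡weight-[] = cong (1ℤ ,_) (sym (expo-[] r t s))
    where
    expo-[] : ∀ r t s → r * 0 + t * 0 + s * 0 ≡ 0
    expo-[] = ℕ-Solver.solve-∀

  weightᵒ-correct : ∀ π → weightᵒ π ≡ (weight ε π , expo r t s π)
  weightᵉ-correct : ∀ π → weightᵉ π ≡ ((-1ℤ ^ᶻ ⌈O⌉ π) *ᶻ (ε ^ᶻ ⌊O⌋ π) , r * ⌈E⌉ π + t * ⌊E⌋ π + s * ⌊O⌋ π)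
  weightᵒ-correct [] = 1ᵐ≡weight-[]
  weightᵒ-correct (x ∷ xs) rewrite weightᵉ-correct xs =
    cong₂ _,_ (ℤP.*-identityˡ _) (expo-∷ r t s ⌈ x /2⌉ ⌊ x /2⌋ (⌈E⌉ xs) (⌊E⌋ xs) (⌊O⌋ xs))
    where
    expo-∷ : ∀ r t s a b c d e → r * a + t * b + (r * c + t * d + s * e) ≡ r * (a + c) + t * (b + d) + s * e
    expo-∷ = ℕ-Solver.solve-∀
  weightᵉ-correct [] = 1ᵐ≡weight-[]
  weightᵉ-correct (x ∷ xs) rewrite weightᵒ-correct xs = cong₂ _,_ (begin
    ((-1ℤ ^ᶻ ⌈ x /2⌉) *ᶻ (ε ^ᶻ ⌊ x /2⌋)) *ᶻ ((-1ℤ ^ᶻ ⌈E⌉ xs) *ᶻ (ε ^ᶻ ⌊E⌋ xs))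
      ≡⟨ *-interchange (-1ℤ ^ᶻ ⌈ x /2⌉) (ε ^ᶻ ⌊ x /2⌋) (-1ℤ ^ᶻ ⌈E⌉ xs) (ε ^ᶻ ⌊E⌋ xs) ⟩
    ((-1ℤ ^ᶻ ⌈ x /2⌉) *ᶻ (-1ℤ ^ᶻ ⌈E⌉ xs)) *ᶻ ((ε ^ᶻ ⌊ x /2⌋) *ᶻ (ε ^ᶻ ⌊E⌋ xs))
      ≡⟨ sym (cong₂ _*ᶻ_ (ℤP.^-distribˡ-+-* -1ℤ ⌈ x /2⌉ (⌈E⌉ xs)) (ℤP.^-distribˡ-+-* ε ⌊ x /2⌋ (⌊E⌋ xs))) ⟩
    (-1ℤ ^ᶻ (⌈ x /2⌉ + ⌈E⌉ xs)) *ᶻ (ε ^ᶻ (⌊ x /2⌋ + ⌊E⌋ xs)) ∎)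
    (expo-∷ r t s ⌊ x /2⌋ (⌈O⌉ xs) (⌊O⌋ xs) (⌊E⌋ xs))
    where
    open ≡-Reasoning
    expo-∷ : ∀ r t s a b c d → s * a + (r * b + t * c + s * d) ≡ r * b + t * c + s * (a + d)
    expo-∷ = ℕ-Solver.solve-∀

  ∑weight≡coeff : ∀ (Q : List ℕ → Set) (D : List (List ℕ)) N L → Unique L → Unique D →
    (∀ π → π ∈ L ⇔ (Q π × expo r t s π ≡ N)) →
    (∀ {π} → Q π → expo r t s π ≡ N → π ∈ D) → (∀ {π} → π ∈ D → Q π) →
    ∑ (weight ε) L ≡ coeff (map weightᵒ D) N
  ∑weight≡coeff Q D N L L! D! L-spec D-complete D-sound = begin
    ∑ (weight ε) L
      ≡⟨ ∑-sameMembers (weight ε) L D[N] L! (Unique.filter⁺ expo≟N D!) L⇔D[N] ⟩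
    ∑ (weight ε) D[N]
      ≡⟨ ∑-filter (weight ε) (expo r t s) N D ⟩
    ∑ (λ π → when (N ≡ᵇ expo r t s π) (weight ε π)) D
      ≡⟨ ∑-cong (λ π → sym (cong (coeffᵐ N) (weightᵒ-correct π))) D ⟩
    ∑ (coeffᵐ N ∘ weightᵒ) D
      ≡⟨ sym (∑-map (coeffᵐ N) weightᵒ D) ⟩
    coeff (map weightᵒ D) N ∎
    where
    open ≡-Reasoning
    expo≟N = λ π → expo r t s π ℕ.≟ N
    D[N] = filter expo≟N D
    L⇔D[N] : ∀ π → π ∈ L ⇔ π ∈ D[N]
    L⇔D[N] π = mk⇔
      (λ π∈L → let (Qπ , expo≡N) = Equivalence.to (L-spec π) π∈L in ∈-filter⁺ expo≟N (D-complete Qπ expo≡N) expo≡N)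
      (λ π∈D[N] → let (π∈D , expo≡N) = ∈-filter⁻ expo≟N π∈D[N] in Equivalence.from (L-spec π) (D-sound π∈D , expo≡N))

  -- Since r + t > 0, a part x contributes at least ⌊x/2⌋ to the exponent.
  parts-bounded : 0 < r + t → ∀ {π} → Linked _≥_ π → All (_≤ suc (double (expo r t s π))) π
  parts-bounded r+t>0 {[]} _ = []
  parts-bounded r+t>0 {x ∷ xs} lk = All.map (λ y≤x → ℕP.≤-trans y≤x x≤) (ℕP.≤-refl ∷ atMost-head lk)
    where
    ⌊x/2⌋≤ : ∀ r t → 0 < r + t → ⌊ x /2⌋ ≤ r * (⌈ x /2⌉ + ⌈E⌉ xs) + t * (⌊ x /2⌋ + ⌊E⌋ xs)
    ⌊x/2⌋≤ (suc r) t _ = ℕP.≤-trans (ℕP.⌊n/2⌋≤⌈n/2⌉ x) (ℕP.≤-trans (ℕP.m≤m+n ⌈ x /2⌉ (⌈E⌉ xs))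
      (ℕP.≤-trans (ℕP.m≤n*m (⌈ x /2⌉ + ⌈E⌉ xs) (suc r)) (ℕP.m≤m+n _ _)))
    ⌊x/2⌋≤ zero (suc t) _ = ℕP.≤-trans (ℕP.m≤m+n ⌊ x /2⌋ (⌊E⌋ xs)) (ℕP.m≤n*m (⌊ x /2⌋ + ⌊E⌋ xs) (suc t))
    x≤ : x ≤ suc (double (expo r t s (x ∷ xs)))
    x≤ = ℕP.≤-trans (≤1+double⌊/2⌋ x) (s≤s (double-mono-≤ (ℕP.≤-trans (⌊x/2⌋≤ r t r+t>0) (ℕP.m≤m+n _ _))))

  map-weightᵒ-∷ : ∀ x Π → map weightᵒ (map (x ∷_) Π) ≡ oddPartWeight x ⊙ map weightᵉ Π
  map-weightᵒ-∷ x [] = refl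
  map-weightᵒ-∷ x (π ∷ Π) = cong (oddPartWeight x · weightᵉ π ∷_) (map-weightᵒ-∷ x Π)

  map-weightᵉ-∷ : ∀ x Π → map weightᵉ (map (x ∷_) Π) ≡ evenPartWeight x ⊙ map weightᵒ Π
  map-weightᵉ-∷ x [] = refl
  map-weightᵉ-∷ x (π ∷ Π) = cong (evenPartWeight x · weightᵒ π ∷_) (map-weightᵉ-∷ x Π)

  evenPartWeight-0 : evenPartWeight 0 ≡ 1ᵐ
  evenPartWeight-0 = cong (1ℤ ,_) (ℕP.*-zeroʳ s)

  evenPartWeight-1 : evenPartWeight 1 ≡ negᵐ 1ᵐ
  evenPartWeight-1 = cong (-1ℤ ,_) (ℕP.*-zeroʳ s)

  evenPartWeight-odd : ∀ j → evenPartWeight (suc (double j)) ≡ negᵐ (evenPartWeight (double j))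
  evenPartWeight-odd j rewrite ⌊1+double/2⌋ j | ⌊double/2⌋ j = cong (_, s * j) (lemma (-1ℤ ^ᶻ j) (ε ^ᶻ j))
    where
    lemma : ∀ a b → (-1ℤ *ᶻ a) *ᶻ b ≡ - (a *ᶻ b)
    lemma = ℤ-Solver.solve-∀

  -^-as-product : ∀ j → (- ε) ^ᶻ j ≡ (-1ℤ ^ᶻ j) *ᶻ (ε ^ᶻ j)
  -^-as-product zero = refl
  -^-as-product (suc j) = trans (cong ((- ε) *ᶻ_) (-^-as-product j)) (lemma ε (-1ℤ ^ᶻ j) (ε ^ᶻ j))
    where
    lemma : ∀ e a b → - e *ᶻ (a *ᶻ b) ≡ (-1ℤ *ᶻ a) *ᶻ (e *ᶻ b)
    lemma = ℤ-Solver.solve-∀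

  distinctGFᵒ distinctGFᵉ : ℕ → Poly
  distinctGFᵒ m = map weightᵒ (distinctUpTo m)
  distinctGFᵉ m = map weightᵉ (distinctUpTo m)

  distinctGFᵒ-suc : ∀ m → distinctGFᵒ (suc m) ≡ distinctGFᵒ m ++ oddPartWeight (suc m) ⊙ distinctGFᵉ m
  distinctGFᵒ-suc m = trans (LP.map-++ weightᵒ (distinctUpTo m) _) (cong (distinctGFᵒ m ++_) (map-weightᵒ-∷ (suc m) (distinctUpTo m)))

  distinctGFᵉ-suc : ∀ m → distinctGFᵉ (suc m) ≡ distinctGFᵉ m ++ evenPartWeight (suc m) ⊙ distinctGFᵒ m
  distinctGFᵉ-suc m = trans (LP.map-++ weightᵉ (distinctUpTo m) _) (cong (distinctGFᵉ m ++_) (map-weightᵉ-∷ (suc m) (distinctUpTo m)))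

  -- The j-th factor pairs the odd-indexed part 2j + 1 with the even-indexed part 2j.
  distinctFactor : ℕ → Monomial
  distinctFactor j = oddPartWeight (suc (double j)) · evenPartWeight (double j)

  distinctFactor≡ : ∀ j → distinctFactor j ≡ (- (-1ℤ *ᶻ ((- ε) ^ᶻ j)) , r + R * j)
  distinctFactor≡ j rewrite ⌊1+double/2⌋ j | ⌊double/2⌋ j | -^-as-product j =
    cong₂ _,_ (lemma (-1ℤ ^ᶻ j) (ε ^ᶻ j)) (degree r t s j)
    where
    lemma : ∀ a b → 1ℤ *ᶻ (a *ᶻ b) ≡ - (-1ℤ *ᶻ (a *ᶻ b))
    lemma = ℤ-Solver.solve-∀
    degree : ∀ r t s j → r * suc j + t * j + s * j ≡ r + (r + t + s) * j
    degree = ℕ-Solver.solve-∀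

  distinctProduct : ℕ → Poly
  distinctProduct zero = 1ᵐ ∷ []
  distinctProduct (suc k) = distinctProduct k ++ distinctFactor k ⊙ distinctProduct k

  distinctGF-odd : ∀ N k → (distinctGFᵒ (suc (double k)) ≈[ N ] distinctProduct (suc k))
                        × (distinctGFᵉ (suc (double k)) ≈[ N ] [])
  distinctGF-odd N zero = Fᵒ≈ , Fᵉ≈
    where
    Fᵒ≈ : distinctGFᵒ 1 ≈[ N ] distinctProduct 1
    Fᵒ≈ = ++-cong {A = 1ᵐ ∷ []} ≈-refl
      (⊙-congˡ (1ᵐ ∷ []) (trans (sym (·-identityʳ (oddPartWeight 1))) (cong (oddPartWeight 1 ·_) (sym evenPartWeight-0))))
    Fᵉ≈ : distinctGFᵉ 1 ≈[ N ] []
    Fᵉ≈ = ≈-trans (++-cong (≈-sym (⊙-identityˡ (1ᵐ ∷ []))) (⊙-congˡ (1ᵐ ∷ []) evenPartWeight-1)) (⊙-inverseʳ 1ᵐ (1ᵐ ∷ []))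
  distinctGF-odd N (suc k) = Fᵒ≈ , Fᵉ≈
    where
    m = suc (double k)
    IH = distinctGF-odd N k
    a = oddPartWeight (suc (suc m))
    b = evenPartWeight (suc m)
    b′ = evenPartWeight (suc (suc m))
    Fᵒ[m+1]≈ : distinctGFᵒ (suc m) ≈[ N ] distinctGFᵒ m
    Fᵒ[m+1]≈ = ≈-trans (≡⇒≈ (distinctGFᵒ-suc m))
      (≈-trans (++-cong ≈-refl (⊙-cong (oddPartWeight (suc m)) (proj₂ IH))) (++-identityʳ-≈ (distinctGFᵒ m)))
    Fᵉ[m+1]≈ : distinctGFᵉ (suc m) ≈[ N ] b ⊙ distinctGFᵒ m
    Fᵉ[m+1]≈ = ≈-trans (≡⇒≈ (distinctGFᵉ-suc m)) (++-cong (proj₂ IH) ≈-refl)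
    Fᵒ≈ : distinctGFᵒ (suc (suc m)) ≈[ N ] distinctProduct (suc (suc k))
    Fᵒ≈ = ≈-trans (≡⇒≈ (distinctGFᵒ-suc (suc m)))
      (≈-trans (++-cong Fᵒ[m+1]≈ (≈-trans (⊙-cong a Fᵉ[m+1]≈) (⊙-⊙ a b (distinctGFᵒ m))))
               (++-cong (proj₁ IH) (⊙-cong (distinctFactor (suc k)) (proj₁ IH))))
    Fᵉ≈ : distinctGFᵉ (suc (suc m)) ≈[ N ] []
    Fᵉ≈ = ≈-trans (≡⇒≈ (distinctGFᵉ-suc (suc m)))
      (≈-trans (++-cong Fᵉ[m+1]≈ (≈-trans (⊙-cong b′ Fᵒ[m+1]≈) (⊙-congˡ (distinctGFᵒ m) (evenPartWeight-odd (suc k)))))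
               (⊙-inverseʳ b (distinctGFᵒ m)))

  distinctFactorPoly : ℕ → Poly
  distinctFactorPoly = pochFactorPoly -1ℤ r (- ε) R

  distinctProduct≈∏ : ∀ k {N} → distinctProduct k ≈[ N ] ∏ distinctFactorPoly (upTo k)
  distinctProduct≈∏ zero = ≈-refl
  distinctProduct≈∏ (suc k) = ≈-sym (begin
    ∏ distinctFactorPoly (upTo (suc k))
      ≈⟨ ∏-upTo-suc distinctFactorPoly k ⟩
    P ** distinctFactorPoly k
      ≈⟨ **-comm P (distinctFactorPoly k) ⟩
    1ᵐ ⊙ P ++ ((- (-1ℤ *ᶻ ((- ε) ^ᶻ k)) , r + R * k) ⊙ P ++ [])
      ≈⟨ ++-cong (⊙-identityˡ P) (≈-trans (++-identityʳ-≈ _) (⊙-congˡ P (sym (distinctFactor≡ k)))) ⟩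
    P ++ distinctFactor k ⊙ P
      ≈⟨ ++-cong (≈-sym (distinctProduct≈∏ k)) (⊙-cong (distinctFactor k) (≈-sym (distinctProduct≈∏ k))) ⟩
    distinctProduct (suc k) ∎)
    where
    open ≈-Reasoning
    P = ∏ distinctFactorPoly (upTo k)

  coeff-distinctGF : ∀ N → coeff (distinctGFᵒ (suc (double N))) N ≡ poch∞ -1ℤ r (- ε) R N
  coeff-distinctGF N = begin
    coeff (distinctGFᵒ (suc (double N))) N
      ≡⟨ coeff-≡ (proj₁ (distinctGF-odd N N)) N ℕP.≤-refl ⟩
    coeff (distinctProduct (suc N)) N
      ≡⟨ coeff-≡ (distinctProduct≈∏ (suc N)) N ℕP.≤-refl ⟩
    coeff (∏ distinctFactorPoly (upTo (suc N))) N
      ≡⟨ sym (poch∞≡coeff-∏ -1ℤ r (- ε) R N) ⟩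
    poch∞ -1ℤ r (- ε) R N ∎
    where open ≡-Reasoning

  distinct-identity : 0 < r + t → ∀ N L → Unique L → (∀ π → π ∈ L ⇔ (IsDistinctPartition π × expo r t s π ≡ N)) →
    ∑ (weight ε) L ≡ poch∞ -1ℤ r (- ε) R N
  distinct-identity r+t>0 N L L! L-spec = trans
    (∑weight≡coeff IsDistinctPartition (distinctUpTo M) N L L! (distinctUpTo-unique M) L-spec
      (λ π-ok expo≡N → distinctUpTo-complete M π-ok (subst (λ e → All (_≤ suc (double e)) _) expo≡N
                          (parts-bounded r+t>0 (Linked.map ℕP.<⇒≤ (proj₂ π-ok)))))
      (proj₁ ∘ distinctUpTo-sound M))
    (coeff-distinctGF N)
    where
    M = suc (double N)

  -- Removing the largest part leaves parts bounded by it, and one part fewer.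
  map-shortPartitionsUpTo-suc : (f g : List ℕ → Monomial) (w : ℕ → Monomial) →
    (∀ x Π → map f (map (x ∷_) Π) ≡ w x ⊙ map g Π) → ∀ m L {N} →
    map f (shortPartitionsUpTo (suc m) (suc L)) ≈[ N ]
      map f (shortPartitionsUpTo m (suc L)) ++ w (suc m) ⊙ map g (shortPartitionsUpTo (suc m) L)
  map-shortPartitionsUpTo-suc f g w map-∷ m zero = ≈-refl
  map-shortPartitionsUpTo-suc f g w map-∷ m (suc L) = begin
    map f (shortPartitionsUpTo (suc m) (suc (suc L)))
      ≡⟨ LP.map-++ f (partitionsUpTo (suc m) (suc L)) (shortPartitionsUpTo (suc m) (suc L)) ⟩
    map f (partitionsUpTo (suc m) (suc L)) ++ map f (shortPartitionsUpTo (suc m) (suc L))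
      ≈⟨ ++-cong (≡⇒≈ (trans (LP.map-++ f (partitionsUpTo m (suc L)) _) (cong (A ++_) (map-∷ (suc m) (partitionsUpTo (suc m) L)))))
                 (map-shortPartitionsUpTo-suc f g w map-∷ m L) ⟩
    (A ++ w (suc m) ⊙ B) ++ (C ++ w (suc m) ⊙ D)
      ≈⟨ ++-interchange A _ C _ ⟩
    (A ++ C) ++ (w (suc m) ⊙ B ++ w (suc m) ⊙ D)
      ≡⟨ cong₂ _++_ (sym (LP.map-++ f (partitionsUpTo m (suc L)) (shortPartitionsUpTo m (suc L))))
                    (trans (sym (⊙-distrib-++ (w (suc m)) B D)) (cong (w (suc m) ⊙_) (sym (LP.map-++ g (partitionsUpTo (suc m) L) (shortPartitionsUpTo (suc m) L))))) ⟩
    map f (shortPartitionsUpTo m (suc (suc L))) ++ w (suc m) ⊙ map g (shortPartitionsUpTo (suc m) (suc L)) ∎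
    where
    open ≈-Reasoning
    A = map f (partitionsUpTo m (suc L))
    B = map g (partitionsUpTo (suc m) L)
    C = map f (shortPartitionsUpTo m (suc L))
    D = map g (shortPartitionsUpTo (suc m) L)

  partitionFactor : ℕ → Monomial
  partitionFactor j = oddPartWeight (double j) · evenPartWeight (double j)

  partitionFactorPoly : ℕ → Poly
  partitionFactorPoly = pochFactorPoly (- ε) R (- ε) R

  partitionFactorPoly≡ : ∀ k → partitionFactorPoly k ≡ 1ᵐ ∷ negᵐ (partitionFactor (suc k)) ∷ []
  partitionFactorPoly≡ k rewrite ⌊1+double/2⌋ k | ⌊double/2⌋ k =
    cong (λ u → 1ᵐ ∷ u ∷ []) (cong₂ _,_ coefficient (degree r t s k))
    where
    coefficient : - ((- ε) *ᶻ ((- ε) ^ᶻ k)) ≡ - (1ℤ *ᶻ ((-1ℤ ^ᶻ suc k) *ᶻ (ε ^ᶻ suc k)))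
    coefficient = cong -_ (trans (-^-as-product (suc k)) (sym (ℤP.*-identityˡ _)))
    degree : ∀ r t s k → (r + t + s) + (r + t + s) * k ≡ r * suc k + t * suc k + s * suc k
    degree = ℕ-Solver.solve-∀

  partitionProduct : ℕ → Poly
  partitionProduct k = ∏ partitionFactorPoly (upTo k)

  module PartitionGF (r≥1 : 1 ≤ r) (N : ℕ) where

    ≤r* : ∀ x → x ≤ r * x
    ≤r* x = ℕP.m≤n*m x r ⦃ ℕ.>-nonZero r≥1 ⦄

    ⌈O⌉≤expo : ∀ π → ⌈O⌉ π ≤ expo r t s π
    ⌈O⌉≤expo π = ℕP.≤-trans (≤r* (⌈O⌉ π)) (ℕP.≤-trans (ℕP.m≤m+n _ _) (ℕP.m≤m+n _ _))

    ⌈E⌉≤deg-weightᵉ : ∀ π → ⌈E⌉ π ≤ proj₂ (weightᵉ π)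
    ⌈E⌉≤deg-weightᵉ π rewrite weightᵉ-correct π = ℕP.≤-trans (≤r* (⌈E⌉ π)) (ℕP.≤-trans (ℕP.m≤m+n _ _) (ℕP.m≤m+n _ _))

    -- Partitions of exponent N have at most double N parts; those with lengthBound parts
    -- only contribute in degrees above N.
    lengthBound : ℕ
    lengthBound = suc (suc (suc (double N)))

    Fᵒ Fᵉ Fᵒ⁻ Fᵉ⁻ : ℕ → Poly
    Fᵒ m = map weightᵒ (shortPartitionsUpTo m (suc lengthBound))
    Fᵉ m = map weightᵉ (shortPartitionsUpTo m (suc lengthBound))
    Fᵒ⁻ m = map weightᵒ (shortPartitionsUpTo m lengthBound)
    Fᵉ⁻ m = map weightᵉ (shortPartitionsUpTo m lengthBound)

    weightᵒ-long>N : ∀ m → All (λ u → N < proj₂ u) (map weightᵒ (partitionsUpTo m lengthBound))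
    weightᵒ-long>N m = All.tabulate deg>N
      where
      deg>N : ∀ {u} → u ∈ map weightᵒ (partitionsUpTo m lengthBound) → N < proj₂ u
      deg>N u∈ with ∈-map⁻ weightᵒ u∈
      ... | π , π∈ , refl with partitionsUpTo-sound m lengthBound π∈
      ... | (π-pos , _) , _ , length≡bound rewrite weightᵒ-correct π = ℕP.≤-trans
        (double-cancel-≤ {suc N} (ℕP.≤-trans (ℕP.n≤1+n _) (ℕP.≤-trans (ℕP.≤-reflexive (sym length≡bound)) (length≤double⌈O⌉ π-pos))))
        (⌈O⌉≤expo π)

    weightᵉ-long>N : ∀ m → All (λ u → N < proj₂ u) (map weightᵉ (partitionsUpTo m lengthBound))
    weightᵉ-long>N m = All.tabulate deg>N
      where
      deg>N : ∀ {u} → u ∈ map weightᵉ (partitionsUpTo m lengthBound) → N < proj₂ u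
      deg>N u∈ with ∈-map⁻ weightᵉ u∈
      ... | π , π∈ , refl with partitionsUpTo-sound m lengthBound π∈
      ... | (π-pos , _) , _ , length≡bound = ℕP.≤-trans
        (double-cancel-≤ {suc N} (ℕP.≤-pred (ℕP.≤-trans (ℕP.≤-reflexive (sym length≡bound)) (length≤1+double⌈E⌉ π-pos))))
        (⌈E⌉≤deg-weightᵉ π)

    Fᵒ⁻≈Fᵒ : ∀ m → Fᵒ⁻ m ≈[ N ] Fᵒ m
    Fᵒ⁻≈Fᵒ m = ≈-sym (≈-trans (≡⇒≈ (LP.map-++ weightᵒ (partitionsUpTo m lengthBound) (shortPartitionsUpTo m lengthBound)))
                               (++-cong (≈[]-if-degrees-above _ (weightᵒ-long>N m)) ≈-refl))

    Fᵉ⁻≈Fᵉ : ∀ m → Fᵉ⁻ m ≈[ N ] Fᵉ m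
    Fᵉ⁻≈Fᵉ m = ≈-sym (≈-trans (≡⇒≈ (LP.map-++ weightᵉ (partitionsUpTo m lengthBound) (shortPartitionsUpTo m lengthBound)))
                               (++-cong (≈[]-if-degrees-above _ (weightᵉ-long>N m)) ≈-refl))

    Fᵒ-suc : ∀ m → Fᵒ (suc m) ≈[ N ] Fᵒ m ++ oddPartWeight (suc m) ⊙ Fᵉ (suc m)
    Fᵒ-suc m = ≈-trans (map-shortPartitionsUpTo-suc weightᵒ weightᵉ oddPartWeight map-weightᵒ-∷ m lengthBound)
                       (++-cong ≈-refl (⊙-cong (oddPartWeight (suc m)) (Fᵉ⁻≈Fᵉ (suc m))))

    Fᵉ-suc : ∀ m → Fᵉ (suc m) ≈[ N ] Fᵉ m ++ evenPartWeight (suc m) ⊙ Fᵒ (suc m)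
    Fᵉ-suc m = ≈-trans (map-shortPartitionsUpTo-suc weightᵉ weightᵒ evenPartWeight map-weightᵉ-∷ m lengthBound)
                       (++-cong ≈-refl (⊙-cong (evenPartWeight (suc m)) (Fᵒ⁻≈Fᵒ (suc m))))

    Fᵒ-zero : Fᵒ 0 ≡ 1ᵐ ∷ []
    Fᵒ-zero = cong (map weightᵒ) (shortPartitionsUpTo-zero lengthBound)

    Fᵉ-zero : Fᵉ 0 ≡ 1ᵐ ∷ []
    Fᵉ-zero = cong (map weightᵉ) (shortPartitionsUpTo-zero lengthBound)

    oddPartWeight-·-degree≥1 : ∀ m u → 1 ≤ proj₂ (oddPartWeight (suc m) · u)
    oddPartWeight-·-degree≥1 m u =
      ℕP.≤-trans (s≤s z≤n) (ℕP.≤-trans (≤r* ⌈ suc m /2⌉) (ℕP.≤-trans (ℕP.m≤m+n _ _) (ℕP.m≤m+n _ _)))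

    -- From 2j to 2j + 1: with a = oddPartWeight (2j+1), b = evenPartWeight (2j), both
    -- sides of the eliminated recurrence carry the factor 1 + a b, which cancels.
    odd-step : ∀ j → let m = double j in Fᵉ m ≈[ N ] evenPartWeight m ⊙ Fᵒ m →
      (Fᵒ (suc m) ≈[ N ] Fᵒ m) × (Fᵉ (suc m) ≈[ N ] [])
    odd-step j Fᵉ≈bFᵒ = Fᵒ≈ , Fᵉ≈
      where
      m = double j
      a = oddPartWeight (suc m)
      b = evenPartWeight m
      Fᵒ≈ : Fᵒ (suc m) ≈[ N ] Fᵒ m
      Fᵒ≈ = 1+-cancelʳ (Fᵒ (suc m)) (Fᵒ m) (a · b) (oddPartWeight-·-degree≥1 m b) (begin
        Fᵒ (suc m) ++ (a · b) ⊙ Fᵒ (suc m)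
          ≡⟨ cong (λ u → Fᵒ (suc m) ++ u ⊙ Fᵒ (suc m)) (sym (trans (cong (λ v → negᵐ (a · v)) (evenPartWeight-odd j)) (negᵐ-·-negᵐ a b))) ⟩
        Fᵒ (suc m) ++ negᵐ (a · evenPartWeight (suc m)) ⊙ Fᵒ (suc m)
          ≈⟨ coupled-elimination (Fᵒ m) (Fᵉ m) (Fᵒ (suc m)) (Fᵉ (suc m)) a (evenPartWeight (suc m)) (Fᵒ-suc m) (Fᵉ-suc m) ⟩
        Fᵒ m ++ a ⊙ Fᵉ m
          ≈⟨ ++-cong {A = Fᵒ m} ≈-refl (≈-trans (⊙-cong a Fᵉ≈bFᵒ) (⊙-⊙ a b (Fᵒ m))) ⟩
        Fᵒ m ++ (a · b) ⊙ Fᵒ m ∎)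
        where open ≈-Reasoning
      Fᵉ≈ : Fᵉ (suc m) ≈[ N ] []
      Fᵉ≈ = begin
        Fᵉ (suc m)
          ≈⟨ Fᵉ-suc m ⟩
        Fᵉ m ++ evenPartWeight (suc m) ⊙ Fᵒ (suc m)
          ≈⟨ ++-cong Fᵉ≈bFᵒ (≈-trans (⊙-cong (evenPartWeight (suc m)) Fᵒ≈) (⊙-congˡ (Fᵒ m) (evenPartWeight-odd j))) ⟩
        b ⊙ Fᵒ m ++ negᵐ b ⊙ Fᵒ m
          ≈⟨ ⊙-inverseʳ b (Fᵒ m) ⟩
        [] ∎
        where open ≈-Reasoning

    even-step : ∀ k → let m = suc (double k) in Fᵉ m ≈[ N ] [] →
      (Fᵒ (suc m) ++ negᵐ (partitionFactor (suc k)) ⊙ Fᵒ (suc m) ≈[ N ] Fᵒ m)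
      × (Fᵉ (suc m) ≈[ N ] evenPartWeight (suc m) ⊙ Fᵒ (suc m))
    even-step k Fᵉ≈[] =
      ≈-trans (coupled-elimination (Fᵒ m) (Fᵉ m) (Fᵒ (suc m)) (Fᵉ (suc m)) a b (Fᵒ-suc m) (Fᵉ-suc m))
              (≈-trans (++-cong {A = Fᵒ m} ≈-refl (⊙-cong a Fᵉ≈[])) (++-identityʳ-≈ (Fᵒ m)))
      , ≈-trans (Fᵉ-suc m) (++-cong Fᵉ≈[] ≈-refl)
      where
      m = suc (double k)
      a = oddPartWeight (suc m)
      b = evenPartWeight (suc m)

    Fᵉ-even : ∀ j → Fᵉ (double j) ≈[ N ] evenPartWeight (double j) ⊙ Fᵒ (double j)
    Fᵉ-even zero = begin
      Fᵉ 0                          ≡⟨ trans Fᵉ-zero (sym Fᵒ-zero) ⟩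
      Fᵒ 0                          ≈⟨ ⊙-identityˡ (Fᵒ 0) ⟨
      1ᵐ ⊙ Fᵒ 0                     ≈⟨ ⊙-congˡ (Fᵒ 0) (sym evenPartWeight-0) ⟩
      evenPartWeight 0 ⊙ Fᵒ 0       ∎
      where open ≈-Reasoning
    Fᵉ-even (suc j) = proj₂ (even-step j (proj₂ (odd-step j (Fᵉ-even j))))

    Fᵉ-odd : ∀ k → Fᵉ (suc (double k)) ≈[ N ] []
    Fᵉ-odd k = proj₂ (odd-step k (Fᵉ-even k))

    Fᵒ-odd-inverse : ∀ k → Fᵒ (suc (double k)) ** partitionProduct k ≈[ N ] 1ᵐ ∷ []
    Fᵒ-odd-inverse zero = begin
      Fᵒ 1 ** (1ᵐ ∷ [])             ≈⟨ **-comm (Fᵒ 1) (1ᵐ ∷ []) ⟩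
      (1ᵐ ∷ []) ** Fᵒ 1             ≈⟨ **-identityˡ (Fᵒ 1) ⟩
      Fᵒ 1                          ≈⟨ proj₁ (odd-step 0 (Fᵉ-even 0)) ⟩
      Fᵒ 0                          ≡⟨ Fᵒ-zero ⟩
      1ᵐ ∷ []                       ∎
      where open ≈-Reasoning
    Fᵒ-odd-inverse (suc k) = begin
      Fᵒ (suc m′) ** partitionProduct (suc k)
        ≈⟨ **-cong (proj₁ (odd-step (suc k) (Fᵉ-even (suc k)))) (∏-upTo-suc partitionFactorPoly k) ⟩
      Fᵒ m′ ** (partitionProduct k ** P)
        ≈⟨ **-congʳ (Fᵒ m′) (**-comm (partitionProduct k) P) ⟩
      Fᵒ m′ ** (P ** partitionProduct k)
        ≈⟨ **-assoc (Fᵒ m′) P (partitionProduct k) ⟨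
      Fᵒ m′ ** P ** partitionProduct k
        ≈⟨ **-congˡ (partitionProduct k) Fᵒ-times-factor ⟩
      Fᵒ m ** partitionProduct k
        ≈⟨ Fᵒ-odd-inverse k ⟩
      1ᵐ ∷ [] ∎
      where
      open ≈-Reasoning
      m = suc (double k)
      m′ = double (suc k)
      P = partitionFactorPoly k
      Fᵒ-times-factor : Fᵒ m′ ** P ≈[ N ] Fᵒ m
      Fᵒ-times-factor = begin
        Fᵒ m′ ** P
          ≈⟨ **-comm (Fᵒ m′) P ⟩
        P ** Fᵒ m′
          ≡⟨ cong (_** Fᵒ m′) (partitionFactorPoly≡ k) ⟩
        (1ᵐ ∷ negᵐ (partitionFactor (suc k)) ∷ []) ** Fᵒ m′
          ≈⟨ ++-cong (⊙-identityˡ (Fᵒ m′)) (++-identityʳ-≈ _) ⟩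
        Fᵒ m′ ++ negᵐ (partitionFactor (suc k)) ⊙ Fᵒ m′
          ≈⟨ proj₁ (even-step k (Fᵉ-odd k)) ⟩
        Fᵒ m ∎

  partitionPoch : Series
  partitionPoch = poch∞ (- ε) R (- ε) R

  -- The factor of index j is 1 + O(q^(R (j+1))).
  partitionProduct-suc : 1 ≤ R → ∀ k j → k ≤ j → partitionProduct (suc j) ≈[ k ] partitionProduct j
  partitionProduct-suc R≥1 k j k≤j = begin
    partitionProduct (suc j)                           ≈⟨ ∏-upTo-suc partitionFactorPoly j ⟩
    partitionProduct j ** partitionFactorPoly j        ≈⟨ **-congʳ (partitionProduct j) factor≈1 ⟩
    partitionProduct j ** (1ᵐ ∷ [])                    ≈⟨ **-comm (partitionProduct j) (1ᵐ ∷ []) ⟩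
    (1ᵐ ∷ []) ** partitionProduct j                    ≈⟨ **-identityˡ (partitionProduct j) ⟩
    partitionProduct j                                 ∎
    where
    open ≈-Reasoning
    k<R+R*j : k < R + R * j
    k<R+R*j = ℕP.<-≤-trans (s≤s (ℕP.≤-trans k≤j (ℕP.≤-trans (ℕP.m≤n*m j R ⦃ ℕ.>-nonZero R≥1 ⦄) (ℕP.m≤n+m (R * j) (ℕ.pred R)))))
                           (ℕP.≤-reflexive (cong (_+ R * j) (ℕP.suc-pred R ⦃ ℕ.>-nonZero R≥1 ⦄)))
    factor≈1 : partitionFactorPoly j ≈[ k ] 1ᵐ ∷ []
    factor≈1 = ++-cong {A = 1ᵐ ∷ []} ≈-refl (≈[]-if-degrees-above _ (k<R+R*j ∷ []))

  partitionProduct-stable : 1 ≤ R → ∀ k j → k ≤ j → partitionProduct (suc j) ≈[ k ] partitionProduct (suc k)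
  partitionProduct-stable R≥1 k j k≤j with ℕP.m≤n⇒m<n∨m≡n k≤j
  ... | inj₂ refl = ≈-refl
  partitionProduct-stable R≥1 k (suc j) _ | inj₁ (s≤s k≤j) =
    ≈-trans (partitionProduct-suc R≥1 k (suc j) (ℕP.m≤n⇒m≤1+n k≤j)) (partitionProduct-stable R≥1 k j k≤j)

  partitionPoch≡coeff : 1 ≤ R → ∀ N k → k ≤ N → partitionPoch k ≡ coeff (partitionProduct (suc N)) k
  partitionPoch≡coeff R≥1 N k k≤N =
    trans (poch∞≡coeff-∏ (- ε) R (- ε) R k) (sym (coeff-≡ (partitionProduct-stable R≥1 k N k≤N) k ℕP.≤-refl))

  partitionPoch-0 : 1 ≤ R → partitionPoch 0 ≡ 1ℤ
  partitionPoch-0 R≥1 = trans (partitionPoch≡coeff R≥1 0 0 z≤n) (coeff-≡ (partitionProduct-suc R≥1 0 0 z≤n) 0 z≤n)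

  partition-identity : 1 ≤ r → ∀ N L → Unique L → (∀ π → π ∈ L ⇔ (IsPartition π × expo r t s π ≡ N)) →
    ∑ (weight ε) L ≡ recip partitionPoch N
  partition-identity r≥1 N L L! L-spec = begin
    ∑ (weight ε) L
      ≡⟨ ∑weight≡coeff IsPartition D N L L! (shortPartitionsUpTo-unique M (suc lengthBound)) L-spec
                       D-complete (proj₁ ∘ shortPartitionsUpTo-sound M (suc lengthBound)) ⟩
    coeff (Fᵒ M) N
      ≡⟨ recip-unique partitionPoch (coeff (Fᵒ M)) N (partitionPoch-0 R≥1) poch⊛Fᵒ≡one N ℕP.≤-refl ⟩
    recip partitionPoch N ∎
    where
    open ≡-Reasoning
    open PartitionGF r≥1 N
    R≥1 : 1 ≤ R
    R≥1 = ℕP.≤-trans r≥1 (ℕP.≤-trans (ℕP.m≤m+n r t) (ℕP.m≤m+n (r + t) s))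
    M = suc (double (suc N))
    D = shortPartitionsUpTo M (suc lengthBound)
    D-complete : ∀ {π} → IsPartition π → expo r t s π ≡ N → π ∈ D
    D-complete {π} π-ok@(π-pos , π-lk) refl = shortPartitionsUpTo-complete M (suc lengthBound) π-ok
      (All.map (λ x≤ → ℕP.≤-trans x≤ (s≤s (double-mono-≤ (ℕP.n≤1+n _))))
               (parts-bounded (ℕP.≤-trans r≥1 (ℕP.m≤m+n r t)) π-lk))
      (s≤s (ℕP.≤-trans (length≤double⌈O⌉ π-pos) (ℕP.≤-trans (double-mono-≤ (⌈O⌉≤expo π)) (ℕP.m≤n+m _ 3))))
    poch⊛Fᵒ≡one : ∀ n → n ≤ N → (partitionPoch ⊛ coeff (Fᵒ M)) n ≡ one n
    poch⊛Fᵒ≡one n n≤N = begin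
      (partitionPoch ⊛ coeff (Fᵒ M)) n
        ≡⟨ ⊛-cong {g = coeff (Fᵒ M)} n (λ k k≤n → partitionPoch≡coeff R≥1 N k (ℕP.≤-trans k≤n n≤N)) (λ _ _ → refl) ⟩
      (coeff (partitionProduct (suc N)) ⊛ coeff (Fᵒ M)) n
        ≡⟨ sym (coeff-** (partitionProduct (suc N)) (Fᵒ M) n) ⟩
      coeff (partitionProduct (suc N) ** Fᵒ M) n
        ≡⟨ coeff-**-comm (partitionProduct (suc N)) (Fᵒ M) n ⟩
      coeff (Fᵒ M ** partitionProduct (suc N)) n
        ≡⟨ coeff-≡ (Fᵒ-odd-inverse (suc N)) n n≤N ⟩
      coeff (1ᵐ ∷ []) n
        ≡⟨ sym (one≡coeff-1ᵐ n) ⟩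
      one n ∎

-- For r = 0, appending two parts 1 leaves the exponent unchanged, so no finite list contains
-- all partitions of exponent N unless there are none.  In that case N is not a multiple of
-- t + s (else (2k, 2k) would be one), and the reciprocal of a product of factors in q^(t + s)
-- vanishes at N.
module _ (t s : ℕ) (ε : ℤ) where
  open WeightedPartitions 0 t s ε

  parts-++-1-1 : ∀ π → (oddParts (π ++ 1 ∷ 1 ∷ []) ≡ oddParts π ++ 1 ∷ [])
                     × (evenParts (π ++ 1 ∷ 1 ∷ []) ≡ evenParts π ++ 1 ∷ [])
  parts-++-1-1 [] = refl , refl
  parts-++-1-1 (x ∷ π) = cong (x ∷_) (proj₂ (parts-++-1-1 π)) , proj₁ (parts-++-1-1 π)

  ∑⌊/2⌋-++-1 : ∀ xs → sumℕ (map ⌊_/2⌋ (xs ++ 1 ∷ [])) ≡ sumℕ (map ⌊_/2⌋ xs)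
  ∑⌊/2⌋-++-1 [] = refl
  ∑⌊/2⌋-++-1 (x ∷ xs) = cong (⌊ x /2⌋ +_) (∑⌊/2⌋-++-1 xs)

  expo-++-1-1 : ∀ π → expo 0 t s (π ++ 1 ∷ 1 ∷ []) ≡ expo 0 t s π
  expo-++-1-1 π rewrite proj₁ (parts-++-1-1 π) | proj₂ (parts-++-1-1 π)
    | ∑⌊/2⌋-++-1 (oddParts π) | ∑⌊/2⌋-++-1 (evenParts π) = refl

  IsPartition-++-1-1 : ∀ {π} → IsPartition π → IsPartition (π ++ 1 ∷ 1 ∷ [])
  IsPartition-++-1-1 {π} (π-pos , π-lk) = positive π-pos , nonincreasing π π-pos π-lk
    where
    positive : ∀ {π} → All (0 <_) π → All (0 <_) (π ++ 1 ∷ 1 ∷ [])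
    positive [] = s≤s z≤n ∷ s≤s z≤n ∷ []
    positive (0<x ∷ π-pos) = 0<x ∷ positive π-pos
    nonincreasing : ∀ π → All (0 <_) π → Linked _≥_ π → Linked _≥_ (π ++ 1 ∷ 1 ∷ [])
    nonincreasing [] _ _ = ℕP.≤-refl ∷ [-]
    nonincreasing (x ∷ []) (0<x ∷ _) _ = 0<x ∷ ℕP.≤-refl ∷ [-]
    nonincreasing (x ∷ y ∷ π) (_ ∷ π-pos) (x≥y ∷ lk) = x≥y ∷ nonincreasing (y ∷ π) π-pos lk

  partition-of-multiple : ∀ k → Σ (List ℕ) λ π → IsPartition π × expo 0 t s π ≡ k * (0 + t + s)
  partition-of-multiple zero = [] , ([] , []) , lemma t s
    where
    lemma : ∀ t s → t * 0 + s * 0 ≡ 0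
    lemma = ℕ-Solver.solve-∀
  partition-of-multiple (suc k) =
    x ∷ x ∷ [] , (s≤s z≤n ∷ s≤s z≤n ∷ [] , ℕP.≤-refl ∷ [-]) , expo≡
    where
    x = double (suc k)
    lemma : ∀ t s k → t * (suc k + 0) + s * (suc k + 0) ≡ suc k * (0 + t + s)
    lemma = ℕ-Solver.solve-∀
    expo≡ : expo 0 t s (x ∷ x ∷ []) ≡ suc k * (0 + t + s)
    expo≡ rewrite ⌊double/2⌋ k = lemma t s k

  partition-identity-r≡0 : 0 < t → ∀ N L → Unique L → (∀ π → π ∈ L ⇔ (IsPartition π × expo 0 t s π ≡ N)) →
    ∑ (weight ε) L ≡ recip partitionPoch N
  partition-identity-r≡0 t>0 N (π ∷ L) _ L-spec =
    ⊥-elim (closed-under-lengthening⇒empty (_++ 1 ∷ 1 ∷ []) longer (π ∷ L) closed (here refl))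
    where
    longer : ∀ π → length π < length (π ++ 1 ∷ 1 ∷ [])
    longer π = ℕP.<-≤-trans (ℕP.m<m+n (length π) (s≤s z≤n)) (ℕP.≤-reflexive (sym (LP.length-++ π)))
    closed : ∀ {π′} → π′ ∈ π ∷ L → π′ ++ 1 ∷ 1 ∷ [] ∈ π ∷ L
    closed {π′} π′∈ = let (π′-ok , expo≡N) = Equivalence.to (L-spec π′) π′∈ in
      Equivalence.from (L-spec _) (IsPartition-++-1-1 π′-ok , trans (expo-++-1-1 π′) expo≡N)
  partition-identity-r≡0 t>0 N [] _ L-spec with R ∣? N
  ... | yes (divides k N≡kR) = ⊥-elim (∉[] (Equivalence.from (L-spec π) (π-ok , trans expo≡ (sym N≡kR))))
    where
    π = proj₁ (partition-of-multiple k)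
    π-ok = proj₁ (proj₂ (partition-of-multiple k))
    expo≡ = proj₂ (proj₂ (partition-of-multiple k))
    ∉[] : ¬ π ∈ []
    ∉[] ()
  ... | no R∤N = sym (recip-vanishes-off-multiples partitionPoch R (partitionPoch-0 R≥1) poch-off N R∤N)
    where
    R≥1 : 1 ≤ R
    R≥1 = ℕP.≤-trans t>0 (ℕP.m≤m+n t s)
    factor-degrees : ∀ i → DegreesDivisibleBy R (partitionFactorPoly i)
    factor-degrees i = divides 0 refl ∷ ∣m∣n⇒∣m+n ∣-refl (m∣m*n i) ∷ []
    poch-off : ∀ k → ¬ R ∣ k → partitionPoch k ≡ 0ℤ
    poch-off k R∤k = trans (partitionPoch≡coeff R≥1 k k ℕP.≤-refl)
      (coeff-off-multiples (partitionProduct (suc k)) k (∏-degreesDivisibleBy partitionFactorPoly factor-degrees (upTo (suc k))) R∤k)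

theorem4p9 : (r t s : ℕ) → 0 < r + t → (ε : ℤ) → (ε ≡ 1ℤ ⊎ ε ≡ -1ℤ) →
    ((N : ℕ) (L : List (List ℕ)) → Unique L →
      ((π : List ℕ) → (π ∈ L) ⇔ (IsDistinctPartition π × expo r t s π ≡ N)) →
      sumℤ (map (weight ε) L) ≡ poch∞ -1ℤ r (- ε) (r + t + s) N)
    × ((N : ℕ) (L : List (List ℕ)) → Unique L →
      ((π : List ℕ) → (π ∈ L) ⇔ (IsPartition π × expo r t s π ≡ N)) →
      sumℤ (map (weight ε) L) ≡ recip (poch∞ (- ε) (r + t + s) (- ε) (r + t + s)) N)
theorem4p9 zero t s t>0 ε _ =
  WeightedPartitions.distinct-identity 0 t s ε t>0 , partition-identity-r≡0 t s ε t>0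
theorem4p9 (suc r) t s r+t>0 ε _ =
  WeightedPartitions.distinct-identity (suc r) t s ε r+t>0 , WeightedPartitions.partition-identity (suc r) t s ε (s≤s z≤n)
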